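{- Realize $\mathrm{ST}(\mathrm{Jac}(C_{p,q}))$ as the group $G=\langle\mathrm{U}(1)^g,\gamma_q,\gamma_p\rangle\subseteq\mathrm{USp}(2g)$ with identity component $\mathrm{U}(1)^g$. Then only the identity component contributes to the $b_1$-coefficient of characteristic polynomials: every element $M\in G$ with $M\notin\mathrm{U}(1)^g$ has $\mathrm{tr}(M)=0$, i.e. the coefficient of $T^{2g-1}$ in $\det(T\cdot 1-M)$ vanishes.
   Context: Let $p\neq q$ be odd primes, $C_{p,q}:y^q=x^p-1$ the Catalan curve over $\mathbb{Q}$, of genus $g=(p-1)(q-1)/2$. $J=\begin{pmatrix}0&1\\-1&0\end{pmatrix}$, $I$ the $2\times2$ identity; $\mathrm{USp}(2g)$ is with respect to $H=\mathrm{diag}(J,\dots,J)$, and $\mathrm{U}(1)^g$ is the group of $\mathrm{diag}(u_1,\overline{u_1},\dots,u_g,\overline{u_g})$ with $|u_i|=1$. Notation: $\langle x\rangle_r$ is the representative of $x$ mod $r$ in $\{0,\dots,r-1\}$. For $1\le b\le q-1$ let $k_b=\lfloor (pb-q-1)/q\rfloor$; for $0\le t\le q-1$ let $\kappa_t=\sum_{1\le b\le t,\ k_b\ge0}(k_b+1)$. The integer pairs $(a,b)$ with $1\le b\le q-1$, $0\le a\le k_b$ number exactly $g$; order them by increasing $b$ then increasing $a$ and let $(a_i,b_i)$ be the $i$-th pair. A $2g\times2g$ matrix $X$ has $2\times2$ blocks $X[i,j]$. Fix generators $c$ of $(\mathbb{Z}/p\mathbb{Z})^\times$ and $d$ of $(\mathbb{Z}/q\mathbb{Z})^\times$.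 $\gamma_q$: with $t_i=\langle db_i\rangle_q$, $t_i'=q-t_i$, $\gamma_q[i,j]=I$ if $0\le a_i\le k_{t_i}$ and $j=\kappa_{t_i-1}+a_i+1$; $=J$ if $a_i>k_{t_i}$ and $j=\kappa_{t_i'-1}+p-(a_i+1)$; $=0$ otherwise. $\gamma_p$: with $s_i=\langle c(a_i+1)\rangle_p-1$, $b_i'=q-b_i$, $\gamma_p[i,j]=I$ if $0\le s_i\le k_{b_i}$ and $j=\kappa_{b_i-1}+s_i+1$; $=J$ if $s_i>k_{b_i}$ and $j=\kappa_{b_i'-1}+p-(s_i+1)$; $=0$ otherwise. It is known that $\mathrm{ST}(\mathrm{Jac}(C_{p,q}))$ is conjugate to $G$. -}

module Defs where

open import Level using (Level; _⊔_)
open import Data.Bool using (Bool; true; false; if_then_else_; _∧_; not)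
open import Data.Nat as ℕ using (ℕ; zero; suc)
import Data.Nat.DivMod as ℕD
open import Data.Integer as ℤ using (ℤ; +_; -[1+_]; _/ℕ_)
import Data.Integer.Properties as ℤP
open import Data.Fin as F using (Fin; toℕ)
open import Data.List as L using (List; []; _∷_; upTo; concatMap; length; lookup)
open import Data.Product using (Σ; _×_; _,_; proj₁; proj₂; ∃)
open import Relation.Nullary.Decidable using (⌊_⌋)
open import Relation.Binary.PropositionalEquality using (_≡_)
open import Algebra.Bundles using (CommutativeRing)

-- ⟨ x ⟩_r : representative of x mod r in {0,…,r-1} (r ≥ 1; r = 0 unused)
modN : ℕ → ℕ → ℕ
modN x zero    = x
modN x (suc r) = x ℕD.% suc r

floorDiv : ℤ → ℕ → ℤ
floorDiv x zero    = + 0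
floorDiv x (suc r) = x /ℕ suc r

IsGenerator : ℕ → ℕ → Set
IsGenerator p c = ∀ x → 1 ℕ.≤ x → x ℕ.< p → ∃ λ e → modN (c ℕ.^ e) p ≡ x

module Catalan (p q : ℕ) where

  k : ℕ → ℤ
  k b = floorDiv (+ (p ℕ.* b) ℤ.- + q ℤ.- + 1) q

  kterm : ℕ → ℕ
  kterm b with k b
  ... | + n    = suc n
  ... | -[1+ _ ] = 0

  κ : ℕ → ℕ
  κ zero    = 0
  κ (suc t) = κ t ℕ.+ kterm (suc t)

  pairsAt : ℕ → List (ℕ × ℕ)
  pairsAt b with k b
  ... | + n      = L.map (λ a → (a , b)) (upTo (suc n))
  ... | -[1+ _ ] = []

  pairs : List (ℕ × ℕ)
  pairs = concatMap (λ b → pairsAt (suc b)) (upTo (q ℕ.∸ 1))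

  -- g = number of such pairs ( = (p-1)(q-1)/2, the genus )
  g : ℕ
  g = length pairs

  -- (a_i , b_i), with i : Fin g the 0-based version of the paper's index i
  aᵢ bᵢ : Fin g → ℕ
  aᵢ i = proj₁ (lookup pairs i)
  bᵢ i = proj₂ (lookup pairs i)

  -- 2g × 2g matrices over a commutative ring, as 2×2 block matrices
  -- X[i,j] has entries  X i α j β  (α β : Fin 2),  all indices 0-based.

  module Matrices {o ℓ : Level} (R : CommutativeRing o ℓ) where
    open CommutativeRing R

    Mat : Set o
    Mat = Fin g → Fin 2 → Fin g → Fin 2 → Carrier

    _≈ₘ_ : Mat → Mat → Set ℓ
    M ≈ₘ N = ∀ i α j β → M i α j β ≈ N i α j β

    sumFin : ∀ {n} → (Fin n → Carrier) → Carrier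
    sumFin {zero}  f = 0#
    sumFin {suc n} f = f F.zero + sumFin (λ i → f (F.suc i))

    _⊗_ : Mat → Mat → Mat
    (M ⊗ N) i α j β = sumFin (λ l → sumFin (λ δ → M i α l δ * N l δ j β))

    I₂ J₂ : Fin 2 → Fin 2 → Carrier
    I₂ F.zero F.zero = 1#
    I₂ (F.suc F.zero) (F.suc F.zero) = 1#
    I₂ _ _ = 0#
    J₂ F.zero (F.suc F.zero) = 1#
    J₂ (F.suc F.zero) F.zero = - 1#
    J₂ _ _ = 0#

    one : Mat
    one i α j β = if ⌊ i F.≟ j ⌋ then I₂ α β else 0#

    trace : Mat → Carrier
    trace M = sumFin (λ i → sumFin (λ α → M i α i α))

    γq : ℕ → Mat
    γq d i α j β =
      if ⌊ + a ℤ.≤? k t ⌋ ∧ ⌊ toℕ j ℕ.≟ κ (t ℕ.∸ 1) ℕ.+ a ⌋ then I₂ α β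
      else if not ⌊ + a ℤ.≤? k t ⌋ ∧ ⌊ toℕ j ℕ.+ (a ℕ.+ 2) ℕ.≟ κ (t′ ℕ.∸ 1) ℕ.+ p ⌋
           then J₂ α β
      else 0#
      where
        a  = aᵢ i
        t  = modN (d ℕ.* bᵢ i) q
        t′ = q ℕ.∸ t

    γp : ℕ → Mat
    γp c i α j β =
      if ⌊ + 0 ℤ.≤? s ⌋ ∧ ⌊ s ℤ.≤? k b ⌋ ∧ ⌊ + toℕ j ℤ.≟ + κ (b ℕ.∸ 1) ℤ.+ s ⌋ then I₂ α β
      else if not ⌊ s ℤ.≤? k b ⌋ ∧ ⌊ + toℕ j ℤ.+ s ℤ.+ + 2 ℤ.≟ + (κ (b′ ℕ.∸ 1) ℕ.+ p) ⌋
           then J₂ α β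
      else 0#
      where
        b  = bᵢ i
        s  = + modN (c ℕ.* (aᵢ i ℕ.+ 1)) p ℤ.- + 1
        b′ = q ℕ.∸ b

    -- Complex conjugation is modelled by a ring involution
    record Involution : Set (o ⊔ ℓ) where
      field
        conj      : Carrier → Carrier
        conj-cong : ∀ {x y} → x ≈ y → conj x ≈ conj y
        conj-+    : ∀ x y → conj (x + y) ≈ conj x + conj y
        conj-*    : ∀ x y → conj (x * y) ≈ conj x * conj y
        conj-1    : conj 1# ≈ 1#
        conj-conj : ∀ x → conj (conj x) ≈ x

    module WithConj (inv : Involution) where
      open Involution inv

      diagU : (Fin g → Carrier) → Mat
      diagU u i F.zero j F.zero = if ⌊ i F.≟ j ⌋ then u i else 0#
      diagU u i (F.suc F.zero) j (F.suc F.zero) = if ⌊ i F.≟ j ⌋ then conj (u i) else 0#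
      diagU u i _ j _ = 0#

      InU1g : Mat → Set (o ⊔ ℓ)
      InU1g M = Σ (Fin g → Carrier) λ u → (∀ i → u i * conj (u i) ≈ 1#) × (M ≈ₘ diagU u)

      data InG (c d : ℕ) : Mat → Set (o ⊔ ℓ) where
        gen-U1 : ∀ {M} → InU1g M → InG c d M
        gen-γq : InG c d (γq d)
        gen-γp : InG c d (γp c)
        g-one  : InG c d one
        g-mul  : ∀ {M N} → InG c d M → InG c d N → InG c d (M ⊗ N)
        g-inv  : ∀ {M N} → InG c d M → (M ⊗ N) ≈ₘ one → (N ⊗ M) ≈ₘ one → InG c d N
        g-resp : ∀ {M N} → M ≈ₘ N → InG c d M → InG c d N

module Submission where

-- Index the blocks of a 2g × 2g matrix by the lattice points (x , y) = (a + 1 , b), where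
-- 1 ≤ x < p, 1 ≤ y < q and q x < p y. Since p ≠ q are primes, q x ≠ p y, so exactly one of
-- (x , y) and its reflection (p - x , q - y) is such a point. A pair of units (α , β) mod (p , q)
-- therefore permutes these points: scale (x , y) to (α x mod p , β y mod q) and reflect if
-- necessary. Every element of G is monomial with respect to such a permutation: block row i has a
-- single nonzero block diag(u , ū) · J^f, f recording the reflection, in the column of the image
-- of i. This holds for U(1)^g (α = β = 1), γ_q (α = 1, β = d) and γ_p (α = c, β = 1), and is
-- preserved by products and inverses. The trace only sees diagonal blocks with f = false, i.e.
-- points fixed by (α , β) without reflection; one such point forces α ≡ 1 and β ≡ 1, and then
-- the matrix lies in U(1)^g.

open import Defs
open import Level using (Level; _⊔_)
open import Function using (_∘_; _⇔_; mk⇔)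
open import Function.Bundles using (module Equivalence)
import Function.Properties.Equivalence as ⇔
open import Data.Bool using (Bool; true; false; not; _∧_; _xor_; if_then_else_)
import Data.Bool.Properties as Boolₚ
open import Data.Empty using (⊥-elim)
open import Data.Fin as Fin using (Fin; toℕ)
import Data.Fin.Properties as Finₚ
open import Data.Integer as ℤ using (+_; -[1+_]; _/ℕ_)
import Data.Integer.Properties as ℤₚ
import Data.Integer.DivMod as ℤDivMod
import Data.Integer.Tactic.RingSolver as ℤSolver
open import Data.List as List using (List; []; _∷_; _++_; upTo; concatMap; length; lookup)
import Data.List.Properties as Listₚ
open import Data.Maybe using (Maybe; just; nothing)
import Data.Maybe.Properties as Maybeₚ
open import Data.Nat as ℕ using (ℕ; zero; suc; NonZero; z≤n; s≤s; _≤_; _<_; _∸_)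
import Data.Nat.Properties as ℕₚ
open import Data.Nat.DivMod
open import Data.Nat.Divisibility using (divides; ∣⇒≤)
open import Data.Nat.Coprimality using (prime⇒coprime; coprime-Bézout)
open import Data.Nat.GCD using (module Bézout)
open import Data.Nat.Primality using (Prime; euclidsLemma; prime⇒irreducible; prime⇒nonZero; prime⇒nonTrivial)
import Data.Nat.Tactic.RingSolver as ℕSolver
open import Data.Product using (Σ; _×_; _,_; proj₁; proj₂; ∃)
open import Data.Sum using (inj₁; inj₂)
open import Relation.Nullary using (¬_; Dec; yes; no; does)
open import Relation.Nullary.Decidable as Dec using (⌊_⌋; dec-true; dec-false; isYes≗does; does-≡)
open import Relation.Binary.PropositionalEquality
  using (_≡_; _≢_; refl; sym; trans; cong; cong₂; subst; subst₂; module ≡-Reasoning)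
open import Algebra.Bundles using (CommutativeRing)
open import Relation.Binary.Bundles using (Setoid)
import Relation.Binary.Reasoning.Setoid

+-cancelʳ-≤ : ∀ {i j} k → i ℤ.+ k ℤ.≤ j ℤ.+ k → i ℤ.≤ j
+-cancelʳ-≤ {i} {j} k i+k≤j+k =
  subst₂ ℤ._≤_ ([i+k]-k≡i i k) ([i+k]-k≡i j k) (ℤₚ.+-monoˡ-≤ (ℤ.- k) i+k≤j+k)
  where
  [i+k]-k≡i : ∀ i k → i ℤ.+ k ℤ.- k ≡ i
  [i+k]-k≡i = ℤSolver.solve-∀

≤/ℕ⇔*≤ : ∀ a n d .{{_ : NonZero d}} → a ℤ.≤ n /ℕ d ⇔ a ℤ.* + d ℤ.≤ n
≤/ℕ⇔*≤ a n d = mk⇔ to from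
  where
  to : a ℤ.≤ n /ℕ d → a ℤ.* + d ℤ.≤ n
  to a≤n/d = ℤₚ.≤-trans (ℤₚ.*-monoʳ-≤-nonNeg (+ d) a≤n/d) (ℤDivMod.[n/ℕd]*d≤n n d)
  from : a ℤ.* + d ℤ.≤ n → a ℤ.≤ n /ℕ d
  from ad≤n = ℤₚ.≮⇒≥ λ n/d<a → ℤₚ.<-irrefl refl
    (ℤₚ.<-≤-trans (ℤDivMod.n<s[n/ℕd]*d n d)
      (ℤₚ.≤-trans (ℤₚ.*-monoʳ-≤-nonNeg (+ d) (ℤₚ.i<j⇒suc[i]≤j n/d<a)) ad≤n))

nth : ∀ {A : Set} → List A → ℕ → Maybe A
nth []       _       = nothing
nth (x ∷ xs) zero    = just x
nth (x ∷ xs) (suc n) = nth xs n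

module _ {A : Set} where

  open import Data.Nat.Base using (_+_)

  nth-lookup : ∀ (xs : List A) i → nth xs (toℕ i) ≡ just (lookup xs i)
  nth-lookup (x ∷ xs) Fin.zero    = refl
  nth-lookup (x ∷ xs) (Fin.suc i) = nth-lookup xs i

  nth⇒< : ∀ (xs : List A) n {a} → nth xs n ≡ just a → n < length xs
  nth⇒< (x ∷ xs) zero    _  = s≤s z≤n
  nth⇒< (x ∷ xs) (suc n) eq = s≤s (nth⇒< xs n eq)

  nth-++ˡ : ∀ (xs ys : List A) {n} → n < length xs → nth (xs ++ ys) n ≡ nth xs n
  nth-++ˡ (x ∷ xs) ys {zero}  _         = refl
  nth-++ˡ (x ∷ xs) ys {suc n} (s≤s n<l) = nth-++ˡ xs ys n<l

  nth-++ʳ : ∀ (xs ys : List A) n → nth (xs ++ ys) (length xs + n) ≡ nth ys n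
  nth-++ʳ []       ys n = refl
  nth-++ʳ (x ∷ xs) ys n = nth-++ʳ xs ys n

  nth-applyUpTo : ∀ (f : ℕ → A) {k n a} → nth (List.applyUpTo f k) n ≡ just a ⇔ (n < k × f n ≡ a)
  nth-applyUpTo f = mk⇔ (to f) (from f)
    where
    to : ∀ f {k n a} → nth (List.applyUpTo f k) n ≡ just a → n < k × f n ≡ a
    to f {suc k} {zero}  refl = s≤s z≤n , refl
    to f {suc k} {suc n} eq   with to (f ∘ suc) eq
    ... | n<k , fn≡a = s≤s n<k , fn≡a
    from : ∀ f {k n a} → n < k × f n ≡ a → nth (List.applyUpTo f k) n ≡ just a
    from f {suc k} {zero}  (_ , refl)       = refl
    from f {suc k} {suc n} (s≤s n<k , fn≡a) = from (f ∘ suc) (n<k , fn≡a)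

odd-prime⇒3+ : ∀ {p} → Prime p → p ≢ 2 → ∃ λ n → p ≡ 3 ℕ.+ n
odd-prime⇒3+ {0} pp _ with prime⇒nonZero pp
... | ()
odd-prime⇒3+ {1} pp _ with prime⇒nonTrivial pp
... | ()
odd-prime⇒3+ {2} _ p≢2 = ⊥-elim (p≢2 refl)
odd-prime⇒3+ {suc (suc (suc n))} _ _ = n , refl

q*x≢p*y : ∀ {p q x y} → Prime p → Prime q → p ≢ q → 1 ≤ x → x < p → q ℕ.* x ≢ p ℕ.* y
q*x≢p*y {p} {q} {x} {y} pp pq p≢q 1≤x x<p qx≡py
  with euclidsLemma q x pp (divides y (trans qx≡py (ℕₚ.*-comm p y)))
... | inj₂ p∣x = ℕₚ.<⇒≱ x<p (∣⇒≤ {{ℕ.>-nonZero 1≤x}} p∣x)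
... | inj₁ p∣q with prime⇒irreducible pq p∣q
...   | inj₂ p≡q = p≢q p≡q
...   | inj₁ refl with pp
...     | ()

+-shift-≡⇔ : ∀ {r c P} n K → r ℕ.+ c ≡ P → (n ℕ.+ c ≡ K ℕ.+ P ⇔ n ≡ K ℕ.+ r)
+-shift-≡⇔ {r} {c} n K r+c≡P = mk⇔
  (λ n+c≡ → ℕₚ.+-cancelʳ-≡ c n (K ℕ.+ r) (trans n+c≡ (trans (cong (K ℕ.+_) (sym r+c≡P)) (sym (ℕₚ.+-assoc K r c)))))
  (λ { refl → trans (ℕₚ.+-assoc K r c) (cong (K ℕ.+_) r+c≡P) })

+≡+⇔ : ∀ {m n} → + m ≡ + n ⇔ m ≡ n
+≡+⇔ = mk⇔ ℤₚ.+-injective (cong +_)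

does-⇔ : ∀ {P Q : Set} → P ⇔ Q → (p? : Dec P) (q? : Dec Q) → does p? ≡ does q?
does-⇔ P⇔Q p? q? = does-≡ p? (Dec.map (⇔.sym P⇔Q) q?)

⌊⌋-⇔ : ∀ {P Q : Set} → P ⇔ Q → (p? : Dec P) (q? : Dec Q) → ⌊ p? ⌋ ≡ does q?
⌊⌋-⇔ P⇔Q p? q? = trans (isYes≗does p?) (does-⇔ P⇔Q p? q?)

xor-cancelˡ : ∀ a b → a xor (a xor b) ≡ b
xor-cancelˡ a b = trans (sym (Boolₚ.xor-assoc a a b)) (cong (_xor b) (Boolₚ.xor-same a))

select-by-flip : ∀ {a} {A : Set a} (B₁ B₂ B₄ f e : Bool) (X Y z : A) →
  B₁ ≡ not f → (f ≡ false → B₂ ≡ e) → (f ≡ true → B₄ ≡ e) →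
  (if B₁ ∧ B₂ then X else if not B₁ ∧ B₄ then Y else z) ≡ (if e then (if f then Y else X) else z)
select-by-flip _ B₂ _ false e X Y z refl B₂≡e _ rewrite B₂≡e refl with e
... | true  = refl
... | false = refl
select-by-flip _ _ B₄ true e X Y z refl _ B₄≡e rewrite B₄≡e refl = refl

pattern ₀ = Fin.zero
pattern ₁ = Fin.suc Fin.zero

module Modular (n : ℕ) where

  open import Data.Nat.Base using (_+_; _*_; _^_)

  -- m ≥ 2, so that 1 % m ≡ 1
  m : ℕ
  m = 2 + n

  record Invertible (α : ℕ) : Set where
    field
      inverse  : ℕ
      inverseʳ : (α * inverse) % m ≡ 1

  open Invertible public

  *-%-absorbʳ : ∀ a y → (a * (y % m)) % m ≡ (a * y) % m
  *-%-absorbʳ a y = begin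
    (a * (y % m)) % m           ≡⟨ %-distribˡ-* a (y % m) m ⟩
    ((a % m) * (y % m % m)) % m ≡⟨ cong (λ z → ((a % m) * z) % m) (m%n%n≡m%n y m) ⟩
    ((a % m) * (y % m)) % m     ≡⟨ %-distribˡ-* a y m ⟨
    (a * y) % m                 ∎
    where open ≡-Reasoning

  %-*-absorbˡ : ∀ a y → ((y % m) * a) % m ≡ (y * a) % m
  %-*-absorbˡ a y = begin
    ((y % m) * a) % m ≡⟨ cong (_% m) (ℕₚ.*-comm (y % m) a) ⟩
    (a * (y % m)) % m ≡⟨ *-%-absorbʳ a y ⟩
    (a * y) % m       ≡⟨ cong (_% m) (ℕₚ.*-comm a y) ⟩
    (y * a) % m       ∎
    where open ≡-Reasoning

  *-%-assoc : ∀ a b x → (a * ((b * x) % m)) % m ≡ (a * b * x) % m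
  *-%-assoc a b x = trans (*-%-absorbʳ a (b * x)) (cong (_% m) (sym (ℕₚ.*-assoc a b x)))

  *-%≡1 : ∀ {a b} → a % m ≡ 1 → b % m ≡ 1 → (a * b) % m ≡ 1
  *-%≡1 {a} {b} a≡1 b≡1 = trans (%-distribˡ-* a b m) (cong₂ (λ u v → (u * v) % m) a≡1 b≡1)

  private
    interchange : ∀ a b c d → a * b * (c * d) ≡ a * c * (b * d)
    interchange = ℕSolver.solve-∀

  invertible-1 : Invertible 1
  invertible-1 = record { inverse = 1 ; inverseʳ = refl }

  invertible-* : ∀ {α β} → Invertible α → Invertible β → Invertible (α * β)
  invertible-* {α} {β} u v = record
    { inverse  = inverse u * inverse v
    ; inverseʳ = trans (cong (_% m) (interchange α β (inverse u) (inverse v)))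
                       (*-%≡1 {α * inverse u} {β * inverse v} (inverseʳ u) (inverseʳ v))
    }

  invertible-inverse : ∀ {α} (u : Invertible α) → Invertible (inverse u)
  invertible-inverse {α} u = record
    { inverse  = α
    ; inverseʳ = trans (cong (_% m) (ℕₚ.*-comm (inverse u) α)) (inverseʳ u)
    }

  invertible⇒*%≢0 : ∀ {α x} → Invertible α → Invertible x → (α * x) % m ≢ 0
  invertible⇒*%≢0 {α} {x} u v αx≡0 = ℕₚ.1+n≢0 (trans (sym ≡1) ≡0)
    where
    ≡1 : (α * x * (inverse u * inverse v)) % m ≡ 1
    ≡1 = trans (cong (_% m) (interchange α x (inverse u) (inverse v)))
               (*-%≡1 {α * inverse u} {x * inverse v} (inverseʳ u) (inverseʳ v))
    ≡0 : (α * x * (inverse u * inverse v)) % m ≡ 0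
    ≡0 = trans (sym (%-*-absorbˡ (inverse u * inverse v) (α * x)))
               (cong (λ z → (z * (inverse u * inverse v)) % m) αx≡0)

  *-%-identityˡ : ∀ α {x} → α % m ≡ 1 → x < m → (α * x) % m ≡ x
  *-%-identityˡ α {x} α≡1 x<m = begin
    (α * x) % m       ≡⟨ %-*-absorbˡ x α ⟨
    ((α % m) * x) % m ≡⟨ cong (λ z → (z * x) % m) α≡1 ⟩
    (1 * x) % m       ≡⟨ cong (_% m) (ℕₚ.*-identityˡ x) ⟩
    x % m             ≡⟨ m<n⇒m%n≡m x<m ⟩
    x                 ∎
    where open ≡-Reasoning

  *-%-cancelʳ : ∀ α {x} → Invertible x → (α * x) % m ≡ x → α % m ≡ 1
  *-%-cancelʳ α {x} v αx≡x = begin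
    α % m                             ≡⟨ cong (_% m) (ℕₚ.*-identityʳ α) ⟨
    (α * 1) % m                       ≡⟨ cong (λ z → (α * z) % m) (inverseʳ v) ⟨
    (α * ((x * inverse v) % m)) % m   ≡⟨ *-%-absorbʳ α (x * inverse v) ⟩
    (α * (x * inverse v)) % m         ≡⟨ cong (_% m) (rotate α x (inverse v)) ⟩
    (inverse v * (α * x)) % m         ≡⟨ *-%-absorbʳ (inverse v) (α * x) ⟨
    (inverse v * ((α * x) % m)) % m   ≡⟨ cong (λ z → (inverse v * z) % m) αx≡x ⟩
    (inverse v * x) % m               ≡⟨ cong (_% m) (ℕₚ.*-comm (inverse v) x) ⟩
    (x * inverse v) % m               ≡⟨ inverseʳ v ⟩
    1                                 ∎
    where
    open ≡-Reasoning
    rotate : ∀ a b c → a * (b * c) ≡ c * (a * b)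
    rotate = ℕSolver.solve-∀

  +-%≡0⇒+≡m : ∀ {s r} → s < m → r < m → 1 ≤ r → (s + r) % m ≡ 0 → s + r ≡ m
  +-%≡0⇒+≡m {s} {r} s<m r<m 1≤r s+r%m≡0 = trans s+r≡km (trans (cong (_* m) k≡1) (ℕₚ.*-identityˡ m))
    where
    k = (s + r) / m
    s+r≡km : s + r ≡ k * m
    s+r≡km = trans (m≡m%n+[m/n]*n (s + r) m) (cong (_+ k * m) s+r%m≡0)
    k<2 : k < 2
    k<2 = m<n*o⇒m/o<n (subst (s + r <_) (cong (λ z → m + z) (sym (ℕₚ.+-identityʳ m)))
                                (ℕₚ.+-mono-<-≤ s<m (ℕₚ.<⇒≤ r<m)))
    k≡1 : k ≡ 1
    k≡1 with k | s+r≡km | k<2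
    ... | zero        | s+r≡0 | _ = ⊥-elim (ℕₚ.<-irrefl (sym s+r≡0) (ℕₚ.≤-trans 1≤r (ℕₚ.m≤n+m r s)))
    ... | suc zero    | _     | _ = refl
    ... | suc (suc _) | _     | s≤s (s≤s ())

  *-∸-% : ∀ α {x} → x ≤ m → (α * x) % m ≢ 0 → (α * (m ∸ x)) % m ≡ m ∸ (α * x) % m
  *-∸-% α {x} x≤m αx≢0 = begin
    s           ≡⟨ ℕₚ.m+n∸n≡m s r ⟨
    s + r ∸ r   ≡⟨ cong (_∸ r) (+-%≡0⇒+≡m (m%n<n (α * (m ∸ x)) m) (m%n<n (α * x) m) (ℕₚ.n≢0⇒n>0 αx≢0) s+r≡0) ⟩
    m ∸ r       ∎
    where
    open ≡-Reasoning
    s = (α * (m ∸ x)) % m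
    r = (α * x) % m
    s+r≡0 : (s + r) % m ≡ 0
    s+r≡0 = begin
      (s + r) % m                 ≡⟨ %-distribˡ-+ (α * (m ∸ x)) (α * x) m ⟨
      (α * (m ∸ x) + α * x) % m   ≡⟨ cong (_% m) (ℕₚ.*-distribˡ-+ α (m ∸ x) x) ⟨
      (α * (m ∸ x + x)) % m       ≡⟨ cong (λ z → (α * z) % m) (ℕₚ.m∸n+n≡m x≤m) ⟩
      (α * m) % m                 ≡⟨ m*n%n≡0 α m ⟩
      0                           ∎

  prime⇒invertible : Prime m → ∀ {x} → 1 ≤ x → x < m → Invertible x
  prime⇒invertible pm {suc x} _ x<m with coprime-Bézout (prime⇒coprime pm x<m)
  ... | Bézout.-+ a b eq = record
    { inverse  = b
    ; inverseʳ = trans (cong (_% m) (trans (ℕₚ.*-comm (suc x) b) (sym eq))) ([m+kn]%n≡m%n 1 a m)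
    }
  ... | Bézout.+- a b eq = record
    { inverse  = b * suc n
    ; inverseʳ = begin
        (suc x * (b * suc n)) % m          ≡⟨ [m+n]%n≡m%n (suc x * (b * suc n)) m ⟨
        (suc x * (b * suc n) + m) % m      ≡⟨ cong (_% m) (shift (suc x) b a (suc n) eq) ⟩
        (1 + a * suc n * m) % m            ≡⟨ [m+kn]%n≡m%n 1 (a * suc n) m ⟩
        1                                  ∎
    }
    where
    open ≡-Reasoning
    -- 1 + b x = a m, hence x · b (m - 1) = (a m - 1)(m - 1) ≡ 1
    shift : ∀ X B A N → 1 + B * X ≡ A * suc N → X * (B * N) + suc N ≡ 1 + A * N * suc N
    shift X B A N e = begin
      X * (B * N) + suc N    ≡⟨ l X B N ⟩
      1 + N * (1 + B * X)    ≡⟨ cong (λ z → 1 + N * z) e ⟩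
      1 + N * (A * suc N)    ≡⟨ r A N ⟩
      1 + A * N * suc N      ∎
      where
      l : ∀ X B N → X * (B * N) + suc N ≡ 1 + N * (1 + B * X)
      l = ℕSolver.solve-∀
      r : ∀ A N → 1 + N * (A * suc N) ≡ 1 + A * N * suc N
      r = ℕSolver.solve-∀

  generator⇒invertible : Prime m → 2 < m → ∀ {c} → IsGenerator m c → Invertible c
  -- some power of c is 2, so m does not divide c
  generator⇒invertible pm 2<m {c} gen with gen 2 (s≤s z≤n) 2<m
  ... | zero , ()
  ... | suc e , c^[e+1]≡2 with c % m ℕ.≟ 0
  ... | yes c≡0 = ⊥-elim (ℕₚ.1+n≢0 (begin
      2                             ≡⟨ c^[e+1]≡2 ⟨
      (c * c ^ e) % m               ≡⟨ %-distribˡ-* c (c ^ e) m ⟩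
      ((c % m) * (c ^ e % m)) % m   ≡⟨ cong (λ z → (z * (c ^ e % m)) % m) c≡0 ⟩
      0                             ∎))
    where open ≡-Reasoning
  ... | no c≢0 with prime⇒invertible pm (ℕₚ.n≢0⇒n>0 c≢0) (m%n<n c m)
  ... | u = record { inverse = inverse u ; inverseʳ = trans (sym (%-*-absorbˡ (inverse u) c)) (inverseʳ u) }

module Enumeration (p q′ : ℕ) where

  open import Data.Nat.Base using (_+_; _*_)

  q : ℕ
  q = suc q′

  open Catalan p q public

  Point : Set
  Point = ℕ × ℕ

  Above : Point → Set
  Above v = q * proj₁ v < p * proj₂ v

  ≤k⇔above : ∀ a b → + a ℤ.≤ k b ⇔ Above (suc a , b)
  ≤k⇔above a b = ⇔.trans (≤/ℕ⇔*≤ (+ a) numerator q) (mk⇔ to from)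
    where
    numerator = + (p * b) ℤ.- + q ℤ.- + 1
    shift-numerator : ∀ P Q → P ℤ.- Q ℤ.- ℤ.1ℤ ℤ.+ (ℤ.1ℤ ℤ.+ Q) ≡ P
    shift-numerator = ℤSolver.solve-∀
    shift-lhs : + a ℤ.* + q ℤ.+ + suc q ≡ + suc (q * suc a)
    shift-lhs = trans (cong (ℤ._+ + suc q) (sym (ℤₚ.pos-* a q)))
                      (cong +_ (lhs a q))
      where
      lhs : ∀ a q → a * q + suc q ≡ suc (q * suc a)
      lhs = ℕSolver.solve-∀
    to : + a ℤ.* + q ℤ.≤ numerator → Above (suc a , b)
    to aq≤n = ℤₚ.drop‿+≤+ (subst₂ ℤ._≤_ shift-lhs (shift-numerator (+ (p * b)) (+ q))
                                     (ℤₚ.+-monoˡ-≤ (+ suc q) aq≤n))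
    from : Above (suc a , b) → + a ℤ.* + q ℤ.≤ numerator
    from above = +-cancelʳ-≤ (+ suc q)
      (subst₂ ℤ._≤_ (sym shift-lhs) (sym (shift-numerator (+ (p * b)) (+ q))) (ℤ.+≤+ above))

  <kterm⇔≤k : ∀ a b → a < kterm b ⇔ + a ℤ.≤ k b
  <kterm⇔≤k a b with k b
  ... | + n      = mk⇔ (ℤ.+≤+ ∘ ℕₚ.≤-pred) (s≤s ∘ ℤₚ.drop‿+≤+)
  ... | -[1+ _ ] = mk⇔ (λ ()) (λ ())

  <kterm⇔above : ∀ a b → a < kterm b ⇔ Above (suc a , b)
  <kterm⇔above a b = ⇔.trans (<kterm⇔≤k a b) (≤k⇔above a b)

  position : ℕ → ℕ → ℕ
  position a b = κ (b ∸ 1) + a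

  pairsAt≡ : ∀ b → pairsAt b ≡ List.applyUpTo (λ a → a , b) (kterm b)
  pairsAt≡ b with k b
  ... | + n      = Listₚ.map-upTo _ (suc n)
  ... | -[1+ _ ] = refl

  nth-pairsAt : ∀ b {n a b′} → nth (pairsAt b) n ≡ just (a , b′) ⇔ (n < kterm b × (n , b) ≡ (a , b′))
  nth-pairsAt b rewrite pairsAt≡ b = nth-applyUpTo _

  length-pairsAt : ∀ b → length (pairsAt b) ≡ kterm b
  length-pairsAt b = trans (cong length (pairsAt≡ b)) (Listₚ.length-applyUpTo _ (kterm b))

  pairsUpTo : ℕ → List (ℕ × ℕ)
  pairsUpTo t = concatMap (λ b → pairsAt (suc b)) (upTo t)

  pairsUpTo-suc : ∀ t → pairsUpTo (suc t) ≡ pairsUpTo t ++ pairsAt (suc t)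
  pairsUpTo-suc t = begin
    concatMap f (upTo (suc t))                  ≡⟨ cong (concatMap f) (Listₚ.upTo-∷ʳ t) ⟨
    concatMap f (upTo t ++ t ∷ [])              ≡⟨ Listₚ.concatMap-++ f (upTo t) (t ∷ []) ⟩
    pairsUpTo t ++ pairsAt (suc t) ++ []        ≡⟨ cong (pairsUpTo t ++_) (Listₚ.++-identityʳ _) ⟩
    pairsUpTo t ++ pairsAt (suc t)              ∎
    where
    open ≡-Reasoning
    f = λ b → pairsAt (suc b)

  length-pairsUpTo : ∀ t → length (pairsUpTo t) ≡ κ t
  length-pairsUpTo zero    = refl
  length-pairsUpTo (suc t) = begin
    length (pairsUpTo (suc t))                           ≡⟨ cong length (pairsUpTo-suc t) ⟩
    length (pairsUpTo t ++ pairsAt (suc t))              ≡⟨ Listₚ.length-++ (pairsUpTo t) ⟩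
    length (pairsUpTo t) + length (pairsAt (suc t))      ≡⟨ cong₂ _+_ (length-pairsUpTo t) (length-pairsAt (suc t)) ⟩
    κ (suc t)                                            ∎
    where open ≡-Reasoning

  κ-mono : ∀ {b t} → b ≤ t → κ b ≤ κ t
  κ-mono {t = zero}  z≤n = z≤n
  κ-mono {t = suc t} b≤1+t with ℕₚ.m≤n⇒m<n∨m≡n b≤1+t
  ... | inj₁ (s≤s b≤t) = ℕₚ.≤-trans (κ-mono b≤t) (ℕₚ.m≤m+n (κ t) _)
  ... | inj₂ refl      = ℕₚ.≤-refl

  position<κ : ∀ {a b t} → 1 ≤ b → b ≤ t → a < kterm b → position a b < κ t
  position<κ {a} {suc b} _ b≤t a<k = ℕₚ.<-≤-trans (ℕₚ.+-monoʳ-< (κ b) a<k) (κ-mono b≤t)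

  nth-pairsUpTo⁺ : ∀ t {a b} → 1 ≤ b → b ≤ t → a < kterm b →
                   nth (pairsUpTo t) (position a b) ≡ just (a , b)
  nth-pairsUpTo⁺ zero    {b = suc _} _ () _
  nth-pairsUpTo⁺ (suc t) {a} {b} 1≤b b≤1+t a<k rewrite pairsUpTo-suc t with ℕₚ.m≤n⇒m<n∨m≡n b≤1+t
  ... | inj₁ (s≤s b≤t) = begin
    nth (pairsUpTo t ++ pairsAt (suc t)) (position a b)  ≡⟨ nth-++ˡ (pairsUpTo t) (pairsAt (suc t)) pos<length ⟩
    nth (pairsUpTo t) (position a b)                     ≡⟨ nth-pairsUpTo⁺ t 1≤b b≤t a<k ⟩
    just (a , b)                                         ∎
    where
    open ≡-Reasoning
    pos<length = subst (position a b <_) (sym (length-pairsUpTo t)) (position<κ 1≤b b≤t a<k)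
  ... | inj₂ refl = begin
    nth xs (κ t + a)                   ≡⟨ cong (λ l → nth xs (l + a)) (length-pairsUpTo t) ⟨
    nth xs (length (pairsUpTo t) + a)  ≡⟨ nth-++ʳ (pairsUpTo t) (pairsAt (suc t)) a ⟩
    nth (pairsAt (suc t)) a            ≡⟨ Equivalence.from (nth-pairsAt (suc t)) (a<k , refl) ⟩
    just (a , suc t)                   ∎
    where
    open ≡-Reasoning
    xs = pairsUpTo t ++ pairsAt (suc t)

  nth-pairsUpTo⁻ : ∀ t n {a b} → nth (pairsUpTo t) n ≡ just (a , b) →
                   1 ≤ b × b ≤ t × a < kterm b × n ≡ position a b
  nth-pairsUpTo⁻ (suc t) n {a} {b} eq rewrite pairsUpTo-suc t with n ℕ.<? length (pairsUpTo t)
  ... | yes n<l with nth-pairsUpTo⁻ t n (trans (sym (nth-++ˡ (pairsUpTo t) (pairsAt (suc t)) n<l)) eq)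
  ...   | 1≤b , b≤t , a<k , n≡ = 1≤b , ℕₚ.m≤n⇒m≤1+n b≤t , a<k , n≡
  nth-pairsUpTo⁻ (suc t) n {a} {b} eq | no n≮l with Equivalence.to (nth-pairsAt (suc t)) nth-tail
    where
    l = length (pairsUpTo t)
    l+[n∸l]≡n : l + (n ∸ l) ≡ n
    l+[n∸l]≡n = ℕₚ.m+[n∸m]≡n (ℕₚ.≮⇒≥ n≮l)
    nth-tail : nth (pairsAt (suc t)) (n ∸ l) ≡ just (a , b)
    nth-tail = begin
      nth (pairsAt (suc t)) (n ∸ l)                       ≡⟨ nth-++ʳ (pairsUpTo t) (pairsAt (suc t)) (n ∸ l) ⟨
      nth (pairsUpTo t ++ pairsAt (suc t)) (l + (n ∸ l))  ≡⟨ cong (nth (pairsUpTo t ++ pairsAt (suc t))) l+[n∸l]≡n ⟩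
      nth (pairsUpTo t ++ pairsAt (suc t)) n              ≡⟨ eq ⟩
      just (a , b)                                        ∎
      where open ≡-Reasoning
  ... | a<k , refl = s≤s z≤n , ℕₚ.≤-refl , a<k ,
    trans (sym (ℕₚ.m+[n∸m]≡n (ℕₚ.≮⇒≥ n≮l))) (cong (_+ (n ∸ length (pairsUpTo t))) (length-pairsUpTo t))

  private
    pair-valid : ∀ i → 1 ≤ bᵢ i × bᵢ i ≤ q′ × aᵢ i < kterm (bᵢ i) × toℕ i ≡ position (aᵢ i) (bᵢ i)
    pair-valid i = nth-pairsUpTo⁻ q′ (toℕ i) (nth-lookup pairs i)

  1≤bᵢ : ∀ i → 1 ≤ bᵢ i
  1≤bᵢ = proj₁ ∘ pair-valid

  bᵢ<q : ∀ i → bᵢ i < q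
  bᵢ<q = s≤s ∘ proj₁ ∘ proj₂ ∘ pair-valid

  aᵢ<kterm : ∀ i → aᵢ i < kterm (bᵢ i)
  aᵢ<kterm = proj₁ ∘ proj₂ ∘ proj₂ ∘ pair-valid

  toℕ≡position : ∀ i → toℕ i ≡ position (aᵢ i) (bᵢ i)
  toℕ≡position = proj₂ ∘ proj₂ ∘ proj₂ ∘ pair-valid

  toℕ≡position⇔ : ∀ j k → toℕ j ≡ position (aᵢ k) (bᵢ k) ⇔ j ≡ k
  toℕ≡position⇔ j k = mk⇔
    (λ j≡ → Finₚ.toℕ-injective (trans j≡ (sym (toℕ≡position k))))
    (λ { refl → toℕ≡position j })

  module _ {a b} (1≤b : 1 ≤ b) (b<q : b < q) (a<k : a < kterm b) where

    private
      nth-position : nth pairs (position a b) ≡ just (a , b)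
      nth-position = nth-pairsUpTo⁺ q′ 1≤b (ℕₚ.≤-pred b<q) a<k

    index : Fin g
    index = Fin.fromℕ< (nth⇒< pairs (position a b) nth-position)

    lookup-index : lookup pairs index ≡ (a , b)
    lookup-index = Maybeₚ.just-injective (begin
      just (lookup pairs index)  ≡⟨ nth-lookup pairs index ⟨
      nth pairs (toℕ index)      ≡⟨ cong (nth pairs) (Finₚ.toℕ-fromℕ< _) ⟩
      nth pairs (position a b)   ≡⟨ nth-position ⟩
      just (a , b)               ∎)
      where open ≡-Reasoning

module Action (p″ q″ : ℕ) where

  open import Data.Nat.Base using (_+_; _*_)

  p : ℕ
  p = 2 + p″

  open Enumeration p (suc q″) public

  module ModP = Modular p″
  module ModQ = Modular q″

  record InBox (v : Point) : Set where
    constructor box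
    field
      1≤x : 1 ≤ proj₁ v
      x<p : proj₁ v < p
      1≤y : 1 ≤ proj₂ v
      y<q : proj₂ v < q

  reflect : Point → Point
  reflect (x , y) = p ∸ x , q ∸ y

  reflect-box : ∀ {v} → InBox v → InBox (reflect v)
  reflect-box (box 1≤x x<p 1≤y y<q) =
    box (ℕₚ.m<n⇒0<n∸m x<p) (ℕₚ.∸-monoʳ-< 1≤x (ℕₚ.<⇒≤ x<p))
        (ℕₚ.m<n⇒0<n∸m y<q) (ℕₚ.∸-monoʳ-< 1≤y (ℕₚ.<⇒≤ y<q))

  reflect-involutive : ∀ {v} → InBox v → reflect (reflect v) ≡ v
  reflect-involutive (box _ x<p _ y<q) = cong₂ _,_ (ℕₚ.m∸[m∸n]≡n (ℕₚ.<⇒≤ x<p)) (ℕₚ.m∸[m∸n]≡n (ℕₚ.<⇒≤ y<q))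

  above-reflect⇔ : ∀ {x y} → InBox (x , y) → Above (reflect (x , y)) ⇔ p * y < q * x
  above-reflect⇔ {x} {y} (box _ x<p _ _) = mk⇔
    (λ above → ℕₚ.∸-cancelʳ-< {o = p * q} (subst₂ _<_ q[p∸x]≡ p[q∸y]≡ above))
    (λ below → subst₂ _<_ (sym q[p∸x]≡) (sym p[q∸y]≡)
                 (ℕₚ.∸-monoʳ-< below (subst (q * x ≤_) (ℕₚ.*-comm q p) (ℕₚ.*-monoʳ-≤ q (ℕₚ.<⇒≤ x<p)))))
    where
    q[p∸x]≡ : q * (p ∸ x) ≡ p * q ∸ q * x
    q[p∸x]≡ = trans (ℕₚ.*-distribˡ-∸ q p x) (cong (_∸ q * x) (ℕₚ.*-comm q p))
    p[q∸y]≡ : p * (q ∸ y) ≡ p * q ∸ p * y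
    p[q∸y]≡ = ℕₚ.*-distribˡ-∸ p q y

  above? : ∀ v → Dec (Above v)
  above? v = q * proj₁ v ℕ.<? p * proj₂ v

  flip? : Point → Bool
  flip? v = not (does (above? v))

  -- the representative above the diagonal of {v, reflect v}
  fold : Point → Point
  fold v = if flip? v then reflect v else v

  fold-unflipped : ∀ {v} → flip? v ≡ false → fold v ≡ v
  fold-unflipped {v} = cong (if_then reflect v else v)

  fold-flipped : ∀ {v} → flip? v ≡ true → fold v ≡ reflect v
  fold-flipped {v} = cong (if_then reflect v else v)

  data FoldView (v : Point) : Set where
    kept    : Above v → flip? v ≡ false → fold v ≡ v → FoldView v
    flipped : ¬ Above v → flip? v ≡ true → fold v ≡ reflect v → FoldView v

  fold-view : ∀ v → FoldView v
  fold-view v with above? v in eq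
  ... | yes above = kept above flip?≡ (fold-unflipped flip?≡)
    where flip?≡ = cong (not ∘ does) eq
  ... | no ¬above = flipped ¬above flip?≡ (fold-flipped flip?≡)
    where flip?≡ = cong (not ∘ does) eq

  fold-above : ∀ {v} → Above v → flip? v ≡ false × fold v ≡ v
  fold-above {v} above with fold-view v
  ... | kept _ flip?≡false fold≡ = flip?≡false , fold≡
  ... | flipped ¬above _ _      = ⊥-elim (¬above above)

  scale : ℕ → ℕ → Point → Point
  scale α β (x , y) = (α * x) % p , (β * y) % q

  scale-scale : ∀ α β α′ β′ v → scale α β (scale α′ β′ v) ≡ scale (α * α′) (β * β′) v
  scale-scale α β α′ β′ (x , y) = cong₂ _,_ (ModP.*-%-assoc α α′ x) (ModQ.*-%-assoc β β′ y)

  scale-identity : ∀ {α β v} → α % p ≡ 1 → β % q ≡ 1 → InBox v → scale α β v ≡ v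
  scale-identity {α} {β} α≡1 β≡1 (box _ x<p _ y<q) =
    cong₂ _,_ (ModP.*-%-identityˡ α α≡1 x<p) (ModQ.*-%-identityˡ β β≡1 y<q)

  point : Fin g → Point
  point i = suc (aᵢ i) , bᵢ i

  point-above : ∀ i → Above (point i)
  point-above i = Equivalence.to (<kterm⇔above (aᵢ i) (bᵢ i)) (aᵢ<kterm i)

  point-box : ∀ i → InBox (point i)
  point-box i = box (s≤s z≤n) a+1<p (1≤bᵢ i) (bᵢ<q i)
    where
    a+1<p : suc (aᵢ i) < p
    a+1<p = ℕₚ.*-cancelˡ-< q (suc (aᵢ i)) p (ℕₚ.<-≤-trans (point-above i)
            (subst (p * bᵢ i ≤_) (ℕₚ.*-comm p q) (ℕₚ.*-monoʳ-≤ p (ℕₚ.<⇒≤ (bᵢ<q i)))))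

  point-injective : ∀ {i j} → point i ≡ point j → i ≡ j
  point-injective {i} {j} i≡j = Equivalence.to (toℕ≡position⇔ i j)
    (trans (toℕ≡position i) (cong₂ position (ℕₚ.suc-injective (cong proj₁ i≡j)) (cong proj₂ i≡j)))

  pointIndex : ∀ {v} → InBox v → Above v → Fin g
  pointIndex {zero  , _} (box () _ _ _) _
  pointIndex {suc a , b} (box _ _ 1≤b b<q) above = index 1≤b b<q (Equivalence.from (<kterm⇔above a b) above)

  point-pointIndex : ∀ {v} (bv : InBox v) (av : Above v) → point (pointIndex bv av) ≡ v
  point-pointIndex {zero  , _} (box () _ _ _) _
  point-pointIndex {suc a , b} (box _ _ 1≤b b<q) above =
    cong (λ (a , b) → suc a , b) (lookup-index 1≤b b<q (Equivalence.from (<kterm⇔above a b) above))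

  point≡⇒toℕ≡position⇔ : ∀ j k {a b} → point k ≡ (suc a , b) → (toℕ j ≡ position a b ⇔ k ≡ j)
  point≡⇒toℕ≡position⇔ j k pk≡ = ⇔.trans
    (subst (λ n → toℕ j ≡ n ⇔ j ≡ k) (cong₂ position (cong (ℕ.pred ∘ proj₁) pk≡) (cong proj₂ pk≡))
           (toℕ≡position⇔ j k))
    (mk⇔ sym sym)

  module Primes (pp : Prime p) (pq : Prime q) (p≢q : p ≢ q) where

    ¬above⇒below : ∀ {v} → InBox v → ¬ Above v → p * proj₂ v < q * proj₁ v
    ¬above⇒below {x , y} (box 1≤x x<p _ _) ¬above =
      ℕₚ.≤∧≢⇒< (ℕₚ.≮⇒≥ ¬above) (λ py≡qx → q*x≢p*y {y = y} pp pq p≢q 1≤x x<p (sym py≡qx))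

    flip?-reflect : ∀ {v} → InBox v → flip? (reflect v) ≡ not (flip? v)
    flip?-reflect {v} bv with fold-view v
    ... | kept above flip?≡false _ = trans
      (cong not (dec-false (above? (reflect v)) λ above′ →
        ℕₚ.<-asym above (Equivalence.to (above-reflect⇔ bv) above′)))
      (cong not (sym flip?≡false))
    ... | flipped ¬above flip?≡true _ = trans
      (cong not (dec-true (above? (reflect v)) (Equivalence.from (above-reflect⇔ bv) (¬above⇒below bv ¬above))))
      (cong not (sym flip?≡true))

    fold-reflect : ∀ {v} → InBox v → fold (reflect v) ≡ fold v
    fold-reflect {v} bv with fold-view v
    ... | kept _ flip?≡false fold≡ = begin
      fold (reflect v)     ≡⟨ fold-flipped (trans (flip?-reflect bv) (cong not flip?≡false)) ⟩
      reflect (reflect v)  ≡⟨ reflect-involutive bv ⟩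
      v                    ≡⟨ fold≡ ⟨
      fold v               ∎
      where open ≡-Reasoning
    ... | flipped _ flip?≡true fold≡ =
      trans (fold-unflipped (trans (flip?-reflect bv) (cong not flip?≡true))) (sym fold≡)

    fold-valid : ∀ {v} → InBox v → InBox (fold v) × Above (fold v)
    fold-valid {v} bv with fold-view v
    ... | kept above _ fold≡ rewrite fold≡ = bv , above
    ... | flipped ¬above _ fold≡ rewrite fold≡ =
      reflect-box bv , Equivalence.from (above-reflect⇔ bv) (¬above⇒below bv ¬above)

    scale-cancel : ∀ {α β v} → InBox v → scale α β v ≡ v → α % p ≡ 1 × β % q ≡ 1
    scale-cancel {α} {β} (box 1≤x x<p 1≤y y<q) αv≡v =
      ModP.*-%-cancelʳ α (ModP.prime⇒invertible pp 1≤x x<p) (cong proj₁ αv≡v) ,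
      ModQ.*-%-cancelʳ β (ModQ.prime⇒invertible pq 1≤y y<q) (cong proj₂ αv≡v)

    module _ {α β} (uα : ModP.Invertible α) (uβ : ModQ.Invertible β) where

      scale-box : ∀ {v} → InBox v → InBox (scale α β v)
      scale-box {x , y} (box 1≤x x<p 1≤y y<q) =
        box (ℕₚ.n≢0⇒n>0 (ModP.invertible⇒*%≢0 uα (ModP.prime⇒invertible pp 1≤x x<p))) (m%n<n (α * x) p)
            (ℕₚ.n≢0⇒n>0 (ModQ.invertible⇒*%≢0 uβ (ModQ.prime⇒invertible pq 1≤y y<q))) (m%n<n (β * y) q)

      scale-reflect : ∀ {v} → InBox v → scale α β (reflect v) ≡ reflect (scale α β v)
      scale-reflect (box 1≤x x<p 1≤y y<q) = cong₂ _,_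
        (ModP.*-∸-% α (ℕₚ.<⇒≤ x<p) (ModP.invertible⇒*%≢0 uα (ModP.prime⇒invertible pp 1≤x x<p)))
        (ModQ.*-∸-% β (ℕₚ.<⇒≤ y<q) (ModQ.invertible⇒*%≢0 uβ (ModQ.prime⇒invertible pq 1≤y y<q)))

      fold-scale-fold : ∀ {v} → InBox v →
        fold (scale α β (fold v)) ≡ fold (scale α β v) × flip? (scale α β (fold v)) ≡ flip? v xor flip? (scale α β v)
      fold-scale-fold {v} bv with fold-view v
      ... | kept _ flip?≡false fold≡ =
        cong (fold ∘ scale α β) fold≡ ,
        trans (cong (flip? ∘ scale α β) fold≡) (cong (_xor flip? (scale α β v)) (sym flip?≡false))
      ... | flipped _ flip?≡true fold≡ = fold-scale≡ , flip?-scale≡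
        where
        open ≡-Reasoning
        fold-scale≡ : fold (scale α β (fold v)) ≡ fold (scale α β v)
        fold-scale≡ = begin
          fold (scale α β (fold v))       ≡⟨ cong (fold ∘ scale α β) fold≡ ⟩
          fold (scale α β (reflect v))    ≡⟨ cong fold (scale-reflect bv) ⟩
          fold (reflect (scale α β v))    ≡⟨ fold-reflect (scale-box bv) ⟩
          fold (scale α β v)              ∎
        flip?-scale≡ : flip? (scale α β (fold v)) ≡ flip? v xor flip? (scale α β v)
        flip?-scale≡ = begin
          flip? (scale α β (fold v))      ≡⟨ cong (flip? ∘ scale α β) fold≡ ⟩
          flip? (scale α β (reflect v))   ≡⟨ cong flip? (scale-reflect bv) ⟩
          flip? (reflect (scale α β v))   ≡⟨ flip?-reflect (scale-box bv) ⟩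
          not (flip? (scale α β v))       ≡⟨ cong (_xor flip? (scale α β v)) flip?≡true ⟨
          flip? v xor flip? (scale α β v) ∎


      image-valid : ∀ i → InBox (fold (scale α β (point i))) × Above (fold (scale α β (point i)))
      image-valid i = fold-valid (scale-box (point-box i))

      π : Fin g → Fin g
      π i = pointIndex (proj₁ (image-valid i)) (proj₂ (image-valid i))

      point-π : ∀ i → point (π i) ≡ fold (scale α β (point i))
      point-π i = point-pointIndex (proj₁ (image-valid i)) (proj₂ (image-valid i))

      flips : Fin g → Bool
      flips i = flip? (scale α β (point i))

      point-π-unflipped : ∀ {i} → flips i ≡ false → point (π i) ≡ scale α β (point i)
      point-π-unflipped {i} flips≡false = trans (point-π i) (fold-unflipped flips≡false)

      point-π-flipped : ∀ {i} → flips i ≡ true → point (π i) ≡ reflect (scale α β (point i))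
      point-π-flipped {i} flips≡true = trans (point-π i) (fold-flipped flips≡true)

      π-identity : α % p ≡ 1 → β % q ≡ 1 → ∀ i → π i ≡ i × flips i ≡ false
      π-identity α≡1 β≡1 i = point-injective (trans (point-π i) (trans (cong fold scale≡) fold≡)) ,
                             trans (cong flip? scale≡) flip?≡false
        where
        scale≡ = scale-identity {α} {β} α≡1 β≡1 (point-box i)
        flip?≡false = proj₁ (fold-above {point i} (point-above i))
        fold≡ = proj₂ (fold-above {point i} (point-above i))

      fixed⇒identity : ∀ i → π i ≡ i → flips i ≡ false → α % p ≡ 1 × β % q ≡ 1
      fixed⇒identity i πi≡i flips≡false =
        scale-cancel {α} {β} (point-box i) (trans (sym (point-π-unflipped flips≡false)) (cong point πi≡i))

      module _ (i : Fin g) {a t} (scaled : scale α β (point i) ≡ (suc a , t)) where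

        π-unflipped : flips i ≡ false → ∀ j → toℕ j ≡ position a t ⇔ π i ≡ j
        π-unflipped flips≡false j = point≡⇒toℕ≡position⇔ j (π i) (trans (point-π-unflipped flips≡false) scaled)

        π-flipped : flips i ≡ true → ∀ j → toℕ j + (a + 2) ≡ κ ((q ∸ t) ∸ 1) + p ⇔ π i ≡ j
        π-flipped flips≡true j = ⇔.trans (+-shift-≡⇔ (toℕ j) (κ (q ∸ t ∸ 1)) r+[a+2]≡p)
                                          (point≡⇒toℕ≡position⇔ j (π i) point-πi≡)
          where
          open ≡-Reasoning
          r = aᵢ (π i)
          point-πi≡reflect : point (π i) ≡ (p ∸ suc a , q ∸ t)
          point-πi≡reflect = trans (point-π-flipped flips≡true) (cong reflect scaled)
          point-πi≡ : point (π i) ≡ (suc r , q ∸ t)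
          point-πi≡ = cong (suc r ,_) (cong proj₂ point-πi≡reflect)
          a<p : suc a < p
          a<p = subst (λ v → proj₁ v < p) scaled (InBox.x<p (scale-box (point-box i)))
          r+[a+2]≡p : r + (a + 2) ≡ p
          r+[a+2]≡p = begin
            r + (a + 2)        ≡⟨ shuffle r a ⟩
            suc r + suc a      ≡⟨ cong (_+ suc a) (cong proj₁ point-πi≡reflect) ⟩
            p ∸ suc a + suc a  ≡⟨ ℕₚ.m∸n+n≡m (ℕₚ.<⇒≤ a<p) ⟩
            p                  ∎
            where
            shuffle : ∀ r a → r + (a + 2) ≡ suc r + suc a
            shuffle = ℕSolver.solve-∀

    module _ {α β α′ β′} (uα : ModP.Invertible α) (uβ : ModQ.Invertible β)
                         (uα′ : ModP.Invertible α′) (uβ′ : ModQ.Invertible β′) where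

      private
        uα′α = ModP.invertible-* uα′ uα
        uβ′β = ModQ.invertible-* uβ′ uβ
        fold-scale-fold′ = fold-scale-fold uα′ uβ′ ∘ scale-box uα uβ ∘ point-box

      π-∘ : ∀ i → π uα′ uβ′ (π uα uβ i) ≡ π uα′α uβ′β i
      π-∘ i = point-injective (begin
        point (π uα′ uβ′ (π uα uβ i))                          ≡⟨ point-π uα′ uβ′ (π uα uβ i) ⟩
        fold (scale α′ β′ (point (π uα uβ i)))                 ≡⟨ cong (fold ∘ scale α′ β′) (point-π uα uβ i) ⟩
        fold (scale α′ β′ (fold (scale α β (point i))))        ≡⟨ proj₁ (fold-scale-fold′ i) ⟩
        fold (scale α′ β′ (scale α β (point i)))               ≡⟨ cong fold (scale-scale α′ β′ α β (point i)) ⟩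
        fold (scale (α′ * α) (β′ * β) (point i))               ≡⟨ point-π uα′α uβ′β i ⟨
        point (π uα′α uβ′β i)                                  ∎)
        where open ≡-Reasoning

      flips-∘ : ∀ i → flips uα′ uβ′ (π uα uβ i) ≡ flips uα uβ i xor flips uα′α uβ′β i
      flips-∘ i = begin
        flip? (scale α′ β′ (point (π uα uβ i)))                  ≡⟨ cong (flip? ∘ scale α′ β′) (point-π uα uβ i) ⟩
        flip? (scale α′ β′ (fold (scale α β (point i))))         ≡⟨ proj₂ (fold-scale-fold′ i) ⟩
        flips uα uβ i xor flip? (scale α′ β′ (scale α β (point i)))
          ≡⟨ cong (λ v → flips uα uβ i xor flip? v) (scale-scale α′ β′ α β (point i)) ⟩
        flips uα uβ i xor flips uα′α uβ′β i                      ∎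
        where open ≡-Reasoning

module Monomial (p q : ℕ) {o ℓ} (R : CommutativeRing o ℓ) (inv : Catalan.Matrices.Involution p q R) where

  open Catalan p q using (g)
  open Catalan.Matrices p q R
  open WithConj inv
  open Involution inv
  open CommutativeRing R hiding (refl; sym; trans)
  open CommutativeRing R using () renaming (refl to ≈-refl; sym to ≈-sym; trans to ≈-trans)
  open import Algebra.Properties.Ring ring using (-‿involutive; -‿distribˡ-*; -‿distribʳ-*; +-inverseˡ-unique; x+x≈x⇒x≈0)
  module ≈-Reasoning = Relation.Binary.Reasoning.Setoid setoid
  import Algebra.Solver.Ring.NaturalCoefficients.Default commutativeSemiring as Solver

  conj-0 : conj 0# ≈ 0#
  conj-0 = x+x≈x⇒x≈0 (conj 0#) (≈-sym (≈-trans (conj-cong (≈-sym (+-identityʳ 0#))) (conj-+ 0# 0#)))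

  conj-neg : ∀ x → conj (- x) ≈ - conj x
  conj-neg x = +-inverseˡ-unique (conj (- x)) (conj x)
    (≈-trans (≈-sym (conj-+ (- x) x)) (≈-trans (conj-cong (-‿inverseˡ x)) conj-0))

  neg-*-neg : ∀ x y → - x * - y ≈ x * y
  neg-*-neg x y = begin
    - x * - y      ≈⟨ -‿distribˡ-* x (- y) ⟨
    - (x * - y)    ≈⟨ -‿cong (-‿distribʳ-* x y) ⟨
    - - (x * y)    ≈⟨ -‿involutive (x * y) ⟩
    x * y          ∎
    where open ≈-Reasoning

  Unitary : Carrier → Set ℓ
  Unitary u = u * conj u ≈ 1#

  unitary-1 : Unitary 1#
  unitary-1 = ≈-trans (*-congˡ conj-1) (*-identityˡ 1#)

  unitary-* : ∀ {u v} → Unitary u → Unitary v → Unitary (u * v)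
  unitary-* {u} {v} unit-u unit-v = begin
    u * v * conj (u * v)        ≈⟨ *-congˡ (conj-* u v) ⟩
    u * v * (conj u * conj v)   ≈⟨ interchange ⟩
    u * conj u * (v * conj v)   ≈⟨ *-cong unit-u unit-v ⟩
    1# * 1#                     ≈⟨ *-identityˡ 1# ⟩
    1#                          ∎
    where
    open ≈-Reasoning
    open Solver
    interchange : u * v * (conj u * conj v) ≈ u * conj u * (v * conj v)
    interchange = solve 4 (λ u v u′ v′ → u :* v :* (u′ :* v′) := u :* u′ :* (v :* v′)) ≈-refl u v (conj u) (conj v)

  unitary-conj : ∀ {u} → Unitary u → Unitary (conj u)
  unitary-conj {u} unit-u = ≈-trans (*-congˡ (conj-conj u)) (≈-trans (*-comm (conj u) u) unit-u)

  unitary-neg : ∀ {u} → Unitary u → Unitary (- u)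
  unitary-neg {u} unit-u = ≈-trans (*-congˡ (conj-neg u)) (≈-trans (neg-*-neg u (conj u)) unit-u)

  sumFin-cong : ∀ {n} {f h : Fin n → Carrier} → (∀ i → f i ≈ h i) → sumFin f ≈ sumFin h
  sumFin-cong {zero}  _   = ≈-refl
  sumFin-cong {suc n} f≈h = +-cong (f≈h Fin.zero) (sumFin-cong (f≈h ∘ Fin.suc))

  sumFin-zero : ∀ {n} {f : Fin n → Carrier} → (∀ i → f i ≈ 0#) → sumFin f ≈ 0#
  sumFin-zero {zero}  _    = ≈-refl
  sumFin-zero {suc n} f≈0 = ≈-trans (+-cong (f≈0 Fin.zero) (sumFin-zero (f≈0 ∘ Fin.suc))) (+-identityˡ 0#)

  sumFin-single : ∀ {n} (k : Fin n) (f : Fin n → Carrier) → (∀ l → l ≢ k → f l ≈ 0#) → sumFin f ≈ f k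
  sumFin-single Fin.zero    f off = ≈-trans (+-congˡ (sumFin-zero (λ i → off (Fin.suc i) (λ ())))) (+-identityʳ _)
  sumFin-single (Fin.suc k) f off = ≈-trans (+-congʳ (off Fin.zero (λ ()))) (≈-trans (+-identityˡ _)
    (sumFin-single k (f ∘ Fin.suc) (λ l l≢k → off (Fin.suc l) (l≢k ∘ Finₚ.suc-injective))))

  sum₂-interchange : ∀ (A : Fin 2 → Carrier) (B : Fin 2 → Fin 2 → Carrier) (C : Fin 2 → Carrier) →
    sumFin (λ ε → A ε * sumFin (λ δ → B ε δ * C δ)) ≈ sumFin (λ δ → sumFin (λ ε → A ε * B ε δ) * C δ)
  sum₂-interchange A B C = solve 8 (λ a₀ a₁ b₀₀ b₀₁ b₁₀ b₁₁ c₀ c₁ →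
      a₀ :* (b₀₀ :* c₀ :+ (b₀₁ :* c₁ :+ con 0)) :+ (a₁ :* (b₁₀ :* c₀ :+ (b₁₁ :* c₁ :+ con 0)) :+ con 0) :=
      (a₀ :* b₀₀ :+ (a₁ :* b₁₀ :+ con 0)) :* c₀ :+ ((a₀ :* b₀₁ :+ (a₁ :* b₁₁ :+ con 0)) :* c₁ :+ con 0))
    ≈-refl (A ₀) (A ₁) (B ₀ ₀) (B ₀ ₁) (B ₁ ₀) (B ₁ ₁) (C ₀) (C ₁)
    where open Solver

  sum₂-first : ∀ {x y z} → x ≈ z → y ≈ 0# → x + (y + 0#) ≈ z
  sum₂-first {z = z} x≈z y≈0 = ≈-trans (+-cong x≈z (≈-trans (+-identityʳ _) y≈0)) (+-identityʳ z)

  sum₂-second : ∀ {x y z} → x ≈ 0# → y ≈ z → x + (y + 0#) ≈ z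
  sum₂-second {z = z} x≈0 y≈z = ≈-trans (+-cong x≈0 (≈-trans (+-identityʳ _) y≈z)) (+-identityˡ z)

  -- block f u = diag(u , ū) · J^f
  block : Bool → Carrier → Fin 2 → Fin 2 → Carrier
  block false u ₀ ₀ = u
  block false u ₁ ₁ = conj u
  block true  u ₀ ₁ = u
  block true  u ₁ ₀ = - conj u
  block _     _ _ _ = 0#

  block-cong : ∀ f {u v} → u ≈ v → ∀ a b → block f u a b ≈ block f v a b
  block-cong false u≈v ₀ ₀ = u≈v
  block-cong false u≈v ₀ ₁ = ≈-refl
  block-cong false u≈v ₁ ₀ = ≈-refl
  block-cong false u≈v ₁ ₁ = conj-cong u≈v
  block-cong true  u≈v ₀ ₀ = ≈-refl
  block-cong true  u≈v ₀ ₁ = u≈v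
  block-cong true  u≈v ₁ ₀ = -‿cong (conj-cong u≈v)
  block-cong true  u≈v ₁ ₁ = ≈-refl

  mulCoeff : Bool → Bool → Carrier → Carrier → Carrier
  mulCoeff false _     u v = u * v
  mulCoeff true  false u v = u * conj v
  mulCoeff true  true  u v = - (u * conj v)

  block-⊗ : ∀ f f′ u v a b →
    sumFin (λ δ → block f u a δ * block f′ v δ b) ≈ block (f xor f′) (mulCoeff f f′ u v) a b
  block-⊗ false false u v ₀ ₀ = sum₂-first ≈-refl (zeroˡ _)
  block-⊗ false false u v ₀ ₁ = sum₂-first (zeroʳ _) (zeroˡ _)
  block-⊗ false false u v ₁ ₀ = sum₂-first (zeroˡ _) (zeroʳ _)
  block-⊗ false false u v ₁ ₁ = sum₂-second (zeroˡ _) (≈-sym (conj-* u v))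
  block-⊗ false true  u v ₀ ₀ = sum₂-first (zeroʳ _) (zeroˡ _)
  block-⊗ false true  u v ₀ ₁ = sum₂-first ≈-refl (zeroˡ _)
  block-⊗ false true  u v ₁ ₀ = sum₂-second (zeroˡ _) (≈-trans (≈-sym (-‿distribʳ-* _ _)) (-‿cong (≈-sym (conj-* u v))))
  block-⊗ false true  u v ₁ ₁ = sum₂-second (zeroˡ _) (zeroʳ _)
  block-⊗ true  false u v ₀ ₀ = sum₂-second (zeroˡ _) (zeroʳ _)
  block-⊗ true  false u v ₀ ₁ = sum₂-second (zeroˡ _) ≈-refl
  block-⊗ true  false u v ₁ ₀ = sum₂-first (≈-trans (≈-sym (-‿distribˡ-* _ _)) (-‿cong (≈-sym conj-u*v̄))) (zeroˡ _)
    where conj-u*v̄ = ≈-trans (conj-* u (conj v)) (*-congˡ (conj-conj v))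
  block-⊗ true  false u v ₁ ₁ = sum₂-first (zeroʳ _) (zeroˡ _)
  block-⊗ true  true  u v ₀ ₀ = sum₂-second (zeroˡ _) (≈-sym (-‿distribʳ-* _ _))
  block-⊗ true  true  u v ₀ ₁ = sum₂-second (zeroˡ _) (zeroʳ _)
  block-⊗ true  true  u v ₁ ₀ = sum₂-first (zeroʳ _) (zeroˡ _)
  block-⊗ true  true  u v ₁ ₁ = sum₂-first (≈-trans (≈-sym (-‿distribˡ-* _ _)) (≈-sym conj-neg-u*v̄)) (zeroˡ _)
    where conj-neg-u*v̄ = ≈-trans (conj-neg _) (-‿cong (≈-trans (conj-* u (conj v)) (*-congˡ (conj-conj v))))

  monomial : (Fin g → Fin g) → (Fin g → Bool) → (Fin g → Carrier) → Mat
  monomial π f u i a j b = if does (π i Fin.≟ j) then block (f i) (u i) a b else 0#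

  Mat-setoid : Setoid o ℓ
  Mat-setoid = record
    { Carrier       = Mat
    ; _≈_           = _≈ₘ_
    ; isEquivalence = record
      { refl  = λ _ _ _ _ → ≈-refl
      ; sym   = λ M≈N i a j b → ≈-sym (M≈N i a j b)
      ; trans = λ M≈N N≈K i a j b → ≈-trans (M≈N i a j b) (N≈K i a j b)
      }
    }

  open Setoid Mat-setoid public using () renaming (refl to ≈ₘ-refl; sym to ≈ₘ-sym; trans to ≈ₘ-trans)

  ⊗-cong : ∀ {M M′ N N′} → M ≈ₘ M′ → N ≈ₘ N′ → (M ⊗ N) ≈ₘ (M′ ⊗ N′)
  ⊗-cong M≈M′ N≈N′ i a j b = sumFin-cong (λ l → sumFin-cong (λ δ → *-cong (M≈M′ i a l δ) (N≈N′ l δ j b)))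

  select-cong : ∀ c {x y} → x ≈ y → (if c then x else 0#) ≈ (if c then y else 0#)
  select-cong true  x≈y = x≈y
  select-cong false x≈y = ≈-refl

  monomial-cong : ∀ {π π′ f f′ u u′} → (∀ i → π i ≡ π′ i) → (∀ i → f i ≡ f′ i) → (∀ i → u i ≈ u′ i) →
                  monomial π f u ≈ₘ monomial π′ f′ u′
  monomial-cong {π} {π′} {f} {f′} {u} {u′} π≡ f≡ u≈ i a j b rewrite π≡ i | f≡ i =
    select-cong (does (π′ i Fin.≟ j)) (block-cong (f′ i) (u≈ i) a b)

  ⊗-monomialˡ : ∀ π f u N i a j b →
    (monomial π f u ⊗ N) i a j b ≈ sumFin (λ δ → block (f i) (u i) a δ * N (π i) δ j b)
  ⊗-monomialˡ π f u N i a j b = ≈-trans (sumFin-single (π i) _ off) (sumFin-cong on)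
    where
    off : ∀ l → l ≢ π i → sumFin (λ δ → monomial π f u i a l δ * N l δ j b) ≈ 0#
    off l l≢πi = sumFin-zero λ δ → ≈-trans
      (*-congʳ (reflexive (cong (if_then block (f i) (u i) a δ else 0#) (dec-false (π i Fin.≟ l) (l≢πi ∘ sym)))))
      (zeroˡ (N l δ j b))
    on : ∀ δ → monomial π f u i a (π i) δ * N (π i) δ j b ≈ block (f i) (u i) a δ * N (π i) δ j b
    on δ = *-congʳ (reflexive (cong (if_then block (f i) (u i) a δ else 0#) (dec-true (π i Fin.≟ π i) refl)))

  monomial-⊗ : ∀ π₁ f₁ u π₂ f₂ v →
    (monomial π₁ f₁ u ⊗ monomial π₂ f₂ v) ≈ₘ
    monomial (π₂ ∘ π₁) (λ i → f₁ i xor f₂ (π₁ i)) (λ i → mulCoeff (f₁ i) (f₂ (π₁ i)) (u i) (v (π₁ i)))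
  monomial-⊗ π₁ f₁ u π₂ f₂ v i a j b = ≈-trans (⊗-monomialˡ π₁ f₁ u (monomial π₂ f₂ v) i a j b)
    (select-sum (does (π₂ (π₁ i) Fin.≟ j)) (block (f₁ i) (u i) a) (λ δ → block (f₂ (π₁ i)) (v (π₁ i)) δ b)
      (block-⊗ (f₁ i) (f₂ (π₁ i)) (u i) (v (π₁ i)) a b))
    where
    select-sum : ∀ c B C {D} → sumFin (λ δ → B δ * C δ) ≈ D →
                 sumFin (λ δ → B δ * (if c then C δ else 0#)) ≈ (if c then D else 0#)
    select-sum true  B C ΣBC≈D = ΣBC≈D
    select-sum false B C _     = sumFin-zero (λ δ → zeroʳ (B δ))

  monomial-⊗-assoc : ∀ π₁ f₁ u π₂ f₂ v N →
    ((monomial π₁ f₁ u ⊗ monomial π₂ f₂ v) ⊗ N) ≈ₘ (monomial π₁ f₁ u ⊗ (monomial π₂ f₂ v ⊗ N))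
  monomial-⊗-assoc π₁ f₁ u π₂ f₂ v N i a j b = begin
    ((M₁ ⊗ M₂) ⊗ N) i a j b
      ≈⟨ ⊗-cong (monomial-⊗ π₁ f₁ u π₂ f₂ v) (≈ₘ-refl {N}) i a j b ⟩
    (monomial (π₂ ∘ π₁) f₁₂ u₁₂ ⊗ N) i a j b
      ≈⟨ ⊗-monomialˡ (π₂ ∘ π₁) f₁₂ u₁₂ N i a j b ⟩
    sumFin (λ δ → block (f₁₂ i) (u₁₂ i) a δ * N′ δ)
      ≈⟨ sumFin-cong (λ δ → *-congʳ {N′ δ} (≈-sym (block-⊗ (f₁ i) (f₂ (π₁ i)) (u i) (v (π₁ i)) a δ))) ⟩
    sumFin (λ δ → sumFin (λ ε → B₁ a ε * B₂ ε δ) * N′ δ)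
      ≈⟨ sum₂-interchange (B₁ a) B₂ N′ ⟨
    sumFin (λ ε → B₁ a ε * sumFin (λ δ → B₂ ε δ * N′ δ))
      ≈⟨ sumFin-cong (λ ε → *-congˡ {B₁ a ε} (⊗-monomialˡ π₂ f₂ v N (π₁ i) ε j b)) ⟨
    sumFin (λ ε → B₁ a ε * (M₂ ⊗ N) (π₁ i) ε j b)
      ≈⟨ ⊗-monomialˡ π₁ f₁ u (M₂ ⊗ N) i a j b ⟨
    (M₁ ⊗ (M₂ ⊗ N)) i a j b
      ∎
    where
    open ≈-Reasoning
    M₁ = monomial π₁ f₁ u
    M₂ = monomial π₂ f₂ v
    B₁ = block (f₁ i) (u i)
    B₂ = block (f₂ (π₁ i)) (v (π₁ i))
    N′ = λ δ → N (π₂ (π₁ i)) δ j b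
    f₁₂ = λ i → f₁ i xor f₂ (π₁ i)
    u₁₂ = λ i → mulCoeff (f₁ i) (f₂ (π₁ i)) (u i) (v (π₁ i))

  unitary-mulCoeff : ∀ f f′ {u v} → Unitary u → Unitary v → Unitary (mulCoeff f f′ u v)
  unitary-mulCoeff false _     unit-u unit-v = unitary-* unit-u unit-v
  unitary-mulCoeff true  false unit-u unit-v = unitary-* unit-u (unitary-conj unit-v)
  unitary-mulCoeff true  true  unit-u unit-v = unitary-neg (unitary-* unit-u (unitary-conj unit-v))

  invCoeff : Bool → Carrier → Carrier
  invCoeff false u = conj u
  invCoeff true  u = - u

  unitary-invCoeff : ∀ f {u} → Unitary u → Unitary (invCoeff f u)
  unitary-invCoeff false = unitary-conj
  unitary-invCoeff true  = unitary-neg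

  mulCoeff-invCoeff : ∀ f {u} → Unitary u → mulCoeff f f (invCoeff f u) u ≈ 1#
  mulCoeff-invCoeff false {u} unit-u = ≈-trans (*-comm (conj u) u) unit-u
  mulCoeff-invCoeff true  {u} unit-u = begin
    - (- u * conj u)   ≈⟨ -‿cong (-‿distribˡ-* u (conj u)) ⟨
    - - (u * conj u)   ≈⟨ -‿involutive (u * conj u) ⟩
    u * conj u         ≈⟨ unit-u ⟩
    1#                 ∎
    where open ≈-Reasoning

  mulCoeff-1 : ∀ f u → mulCoeff f false u 1# ≈ u
  mulCoeff-1 false u = *-identityʳ u
  mulCoeff-1 true  u = ≈-trans (*-congˡ conj-1) (*-identityʳ u)

  select-0 : ∀ c → (if c then 0# else 0#) ≡ 0#
  select-0 true  = refl
  select-0 false = refl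

  monomial-id≈diagU : ∀ u → monomial (λ i → i) (λ _ → false) u ≈ₘ diagU u
  monomial-id≈diagU u i ₀ j ₀ = reflexive (cong (if_then u i else 0#) (sym (isYes≗does (i Fin.≟ j))))
  monomial-id≈diagU u i ₀ j ₁ = reflexive (select-0 (does (i Fin.≟ j)))
  monomial-id≈diagU u i ₁ j ₀ = reflexive (select-0 (does (i Fin.≟ j)))
  monomial-id≈diagU u i ₁ j ₁ = reflexive (cong (if_then conj (u i) else 0#) (sym (isYes≗does (i Fin.≟ j))))

  diagU-1 : diagU (λ _ → 1#) ≈ₘ one
  diagU-1 i ₀ j ₀ = ≈-refl
  diagU-1 i ₀ j ₁ = reflexive (sym (select-0 ⌊ i Fin.≟ j ⌋))
  diagU-1 i ₁ j ₀ = reflexive (sym (select-0 ⌊ i Fin.≟ j ⌋))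
  diagU-1 i ₁ j ₁ = select-cong ⌊ i Fin.≟ j ⌋ conj-1

  id-monomial : Mat
  id-monomial = monomial (λ i → i) (λ _ → false) (λ _ → 1#)

  id-monomial≈one : id-monomial ≈ₘ one
  id-monomial≈one = ≈ₘ-trans (monomial-id≈diagU (λ _ → 1#)) diagU-1

  one-⊗ : ∀ N → (one ⊗ N) ≈ₘ N
  one-⊗ N i a j b = begin
    (one ⊗ N) i a j b                              ≈⟨ ⊗-cong (≈ₘ-sym id-monomial≈one) (≈ₘ-refl {N}) i a j b ⟩
    (id-monomial ⊗ N) i a j b                      ≈⟨ ⊗-monomialˡ (λ i → i) (λ _ → false) (λ _ → 1#) N i a j b ⟩
    sumFin (λ δ → block false 1# a δ * N i δ j b)  ≈⟨ identity-block a ⟩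
    N i a j b                                      ∎
    where
    open ≈-Reasoning
    identity-block : ∀ a → sumFin (λ δ → block false 1# a δ * N i δ j b) ≈ N i a j b
    identity-block ₀ = sum₂-first (*-identityˡ _) (zeroˡ _)
    identity-block ₁ = sum₂-second (zeroˡ _) (≈-trans (*-congʳ conj-1) (*-identityˡ _))

  monomial-⊗-one : ∀ π f u → (monomial π f u ⊗ one) ≈ₘ monomial π f u
  monomial-⊗-one π f u = begin
    monomial π f u ⊗ one
      ≈⟨ ⊗-cong (≈ₘ-refl {monomial π f u}) (≈ₘ-sym id-monomial≈one) ⟩
    monomial π f u ⊗ id-monomial
      ≈⟨ monomial-⊗ π f u (λ i → i) (λ _ → false) (λ _ → 1#) ⟩
    monomial π (λ i → f i xor false) u′
      ≈⟨ monomial-cong {π} {π} {u = u′} (λ _ → refl) (Boolₚ.xor-identityʳ ∘ f) (λ i → mulCoeff-1 (f i) (u i)) ⟩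
    monomial π f u
      ∎
    where
    open Relation.Binary.Reasoning.Setoid Mat-setoid
    u′ = λ i → mulCoeff (f i) false (u i) 1#

  -- M′ below is a left inverse of monomial π f u, hence equal to any right inverse N.
  monomial-right-inverse : ∀ {M N π π⁻¹ f u} → M ≈ₘ monomial π f u → (∀ i → Unitary (u i)) →
    (∀ l → π (π⁻¹ l) ≡ l) → (M ⊗ N) ≈ₘ one →
    N ≈ₘ monomial π⁻¹ (f ∘ π⁻¹) (λ l → invCoeff (f (π⁻¹ l)) (u (π⁻¹ l)))
  monomial-right-inverse {M} {N} {π} {π⁻¹} {f} {u} M≈ unit ππ⁻¹ MN≈one = begin
    N                                ≈⟨ one-⊗ N ⟨
    one ⊗ N                          ≈⟨ ⊗-cong left-inverse (≈ₘ-refl {N}) ⟨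
    (M′ ⊗ monomial π f u) ⊗ N        ≈⟨ monomial-⊗-assoc π⁻¹ (f ∘ π⁻¹) w π f u N ⟩
    M′ ⊗ (monomial π f u ⊗ N)        ≈⟨ ⊗-cong (≈ₘ-refl {M′}) (⊗-cong M≈ (≈ₘ-refl {N})) ⟨
    M′ ⊗ (M ⊗ N)                     ≈⟨ ⊗-cong (≈ₘ-refl {M′}) MN≈one ⟩
    M′ ⊗ one                         ≈⟨ monomial-⊗-one π⁻¹ (f ∘ π⁻¹) w ⟩
    M′                               ∎
    where
    open Relation.Binary.Reasoning.Setoid Mat-setoid
    w = λ l → invCoeff (f (π⁻¹ l)) (u (π⁻¹ l))
    M′ = monomial π⁻¹ (f ∘ π⁻¹) w
    left-inverse : (M′ ⊗ monomial π f u) ≈ₘ one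
    left-inverse = ≈ₘ-trans (monomial-⊗ π⁻¹ (f ∘ π⁻¹) w π f u)
      (≈ₘ-trans (monomial-cong {u′ = λ _ → 1#} ππ⁻¹ (Boolₚ.xor-same ∘ f ∘ π⁻¹)
                                (λ l → mulCoeff-invCoeff (f (π⁻¹ l)) (unit (π⁻¹ l))))
                id-monomial≈one)

  trace-monomial : ∀ {M π f u} → M ≈ₘ monomial π f u → (∀ i → π i ≡ i → f i ≢ false) → trace M ≈ 0#
  trace-monomial {M} {π} {f} {u} M≈ no-fixed = sumFin-zero λ i → sumFin-zero λ a → ≈-trans (M≈ i a i a) (diagonal i a)
    where
    diagonal : ∀ i a → monomial π f u i a i a ≈ 0#
    diagonal i a with π i Fin.≟ i
    ... | no _ = ≈-refl
    ... | yes πi≡i with f i in fi≡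
    ...   | false = ⊥-elim (no-fixed i πi≡i fi≡)
    ...   | true with a
    ...     | ₀ = ≈-refl
    ...     | ₁ = ≈-refl

  block-1 : ∀ f a b → block f 1# a b ≈ (if f then J₂ a b else I₂ a b)
  block-1 false ₀ ₀ = ≈-refl
  block-1 false ₀ ₁ = ≈-refl
  block-1 false ₁ ₀ = ≈-refl
  block-1 false ₁ ₁ = conj-1
  block-1 true  ₀ ₀ = ≈-refl
  block-1 true  ₀ ₁ = ≈-refl
  block-1 true  ₁ ₀ = -‿cong conj-1
  block-1 true  ₁ ₁ = ≈-refl

  select-monomial : ∀ π f i a j b (B₁ B₂ B₄ : Bool) → B₁ ≡ not (f i) →
    (f i ≡ false → B₂ ≡ does (π i Fin.≟ j)) → (f i ≡ true → B₄ ≡ does (π i Fin.≟ j)) →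
    (if B₁ ∧ B₂ then I₂ a b else if not B₁ ∧ B₄ then J₂ a b else 0#) ≈ monomial π f (λ _ → 1#) i a j b
  select-monomial π f i a j b B₁ B₂ B₄ B₁≡ B₂≡ B₄≡ = ≈-trans
    (reflexive (select-by-flip B₁ B₂ B₄ (f i) (does (π i Fin.≟ j)) (I₂ a b) (J₂ a b) 0# B₁≡ B₂≡ B₄≡))
    (select-cong (does (π i Fin.≟ j)) (≈-sym (block-1 (f i) a b)))

module Generators (p″ q″ : ℕ) (pp : Prime (2 ℕ.+ p″)) (pq : Prime (2 ℕ.+ q″)) (p≢q : 2 ℕ.+ p″ ≢ 2 ℕ.+ q″)
                  {o ℓ} (R : CommutativeRing o ℓ) (inv : Catalan.Matrices.Involution (2 ℕ.+ p″) (2 ℕ.+ q″) R) where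

  open Action p″ q″
  open Primes pp pq p≢q
  open Matrices R
  open WithConj inv
  open Monomial p q R inv
  open CommutativeRing R using (Carrier; _≈_; 0#; 1#) renaming (refl to ≈-refl)

  private
    ⌊≤k⌋≡not-flips : ∀ {α β} (uα : ModP.Invertible α) (uβ : ModQ.Invertible β) i {a t} →
      scale α β (point i) ≡ (suc a , t) → ⌊ + a ℤ.≤? k t ⌋ ≡ not (flips uα uβ i)
    ⌊≤k⌋≡not-flips uα uβ i {a} {t} scaled = begin
      ⌊ + a ℤ.≤? k t ⌋                          ≡⟨ ⌊⌋-⇔ (≤k⇔above a t) (+ a ℤ.≤? k t) (above? (suc a , t)) ⟩
      does (above? (suc a , t))                 ≡⟨ Boolₚ.not-involutive _ ⟨
      not (flip? (suc a , t))                   ≡⟨ cong (not ∘ flip?) scaled ⟨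
      not (flips uα uβ i)                       ∎
      where open ≡-Reasoning

  module _ {d} (ud : ModQ.Invertible d) where

    γq≈monomial : γq d ≈ₘ monomial (π ModP.invertible-1 ud) (flips ModP.invertible-1 ud) (λ _ → 1#)
    γq≈monomial i a j b = select-monomial σ (flips ModP.invertible-1 ud) i a j b _ _ _
      (⌊≤k⌋≡not-flips ModP.invertible-1 ud i scaled)
      (λ kept    → ⌊⌋-⇔ (π-unflipped ModP.invertible-1 ud i scaled kept j) (toℕ j ℕ.≟ position (aᵢ i) t) (σ i Fin.≟ j))
      (λ flipped → ⌊⌋-⇔ (π-flipped ModP.invertible-1 ud i scaled flipped j) (_ ℕ.≟ _) (σ i Fin.≟ j))
      where
      σ = π ModP.invertible-1 ud
      t = (d ℕ.* bᵢ i) % q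
      scaled : scale 1 d (point i) ≡ (suc (aᵢ i) , t)
      scaled = cong (_, t) (ModP.*-%-identityˡ 1 refl (InBox.x<p (point-box i)))

  module _ {c} (uc : ModP.Invertible c) where

    γp≈monomial : γp c ≈ₘ monomial (π uc ModQ.invertible-1) (flips uc ModQ.invertible-1) (λ _ → 1#)
    γp≈monomial i a j b = entry _ (cong (λ n → + n ℤ.- + 1) x≡1+s′)
      where
      σ = π uc ModQ.invertible-1
      x = (c ℕ.* (aᵢ i ℕ.+ 1)) % p
      x≡scaled : (c ℕ.* suc (aᵢ i)) % p ≡ x
      x≡scaled = cong (λ n → (c ℕ.* n) % p) (ℕₚ.+-comm 1 (aᵢ i))
      1≤x : 1 ≤ x
      1≤x = subst (1 ≤_) x≡scaled (InBox.1≤x (scale-box uc ModQ.invertible-1 (point-box i)))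
      s′ = ℕ.pred x
      x≡1+s′ : x ≡ suc s′
      x≡1+s′ = sym (ℕₚ.suc-pred x {{ℕ.>-nonZero 1≤x}})
      scaled : scale c 1 (point i) ≡ (suc s′ , bᵢ i)
      scaled = cong₂ _,_ (trans x≡scaled x≡1+s′) (ModQ.*-%-identityˡ 1 refl (InBox.y<q (point-box i)))
      K = κ ((q ∸ bᵢ i) ∸ 1)
      -- γp c i a j b with the integer s = ⟨c (a + 1)⟩_p - 1 of its definition abstracted
      entry : ∀ s → s ≡ + s′ →
        (if ⌊ + 0 ℤ.≤? s ⌋ ∧ ⌊ s ℤ.≤? k (bᵢ i) ⌋ ∧ ⌊ + toℕ j ℤ.≟ + κ (bᵢ i ∸ 1) ℤ.+ s ⌋ then I₂ a b
         else if not ⌊ s ℤ.≤? k (bᵢ i) ⌋ ∧ ⌊ + toℕ j ℤ.+ s ℤ.+ + 2 ℤ.≟ + (K ℕ.+ p) ⌋ then J₂ a b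
         else 0#) ≈ monomial σ (flips uc ModQ.invertible-1) (λ _ → 1#) i a j b
      entry _ refl = select-monomial σ (flips uc ModQ.invertible-1) i a j b _ _ _
        (⌊≤k⌋≡not-flips uc ModQ.invertible-1 i scaled)
        (λ kept → ⌊⌋-⇔ (⇔.trans +≡+⇔ (π-unflipped uc ModQ.invertible-1 i scaled kept j)) (_ ℤ.≟ _) (σ i Fin.≟ j))
        (λ flipped → ⌊⌋-⇔ (⇔.trans +≡+⇔ (⇔.trans reassociate (π-flipped uc ModQ.invertible-1 i scaled flipped j)))
                          (_ ℤ.≟ _) (σ i Fin.≟ j))
        where
        reassociate : toℕ j ℕ.+ s′ ℕ.+ 2 ≡ K ℕ.+ p ⇔ toℕ j ℕ.+ (s′ ℕ.+ 2) ≡ K ℕ.+ p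
        reassociate = mk⇔ (trans (sym (ℕₚ.+-assoc (toℕ j) s′ 2))) (trans (ℕₚ.+-assoc (toℕ j) s′ 2))

  monomial-π-identity : ∀ {α β} (uα : ModP.Invertible α) (uβ : ModQ.Invertible β) → α % p ≡ 1 → β % q ≡ 1 →
                      ∀ u → monomial (π uα uβ) (flips uα uβ) u ≈ₘ diagU u
  monomial-π-identity uα uβ α≡1 β≡1 u = ≈ₘ-trans
    (monomial-cong {u = u} {u′ = u} (proj₁ ∘ identity) (proj₂ ∘ identity) (λ _ → ≈-refl))
    (monomial-id≈diagU u)
    where identity = π-identity uα uβ α≡1 β≡1

  StandardForm : Mat → Set (o ⊔ ℓ)
  StandardForm M = Σ ℕ λ α → Σ ℕ λ β → Σ (ModP.Invertible α) λ uα → Σ (ModQ.Invertible β) λ uβ →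
    Σ (Fin g → Carrier) λ u → (∀ i → Unitary (u i)) × M ≈ₘ monomial (π uα uβ) (flips uα uβ) u

  standardForm-U1 : ∀ {M} → InU1g M → StandardForm M
  standardForm-U1 (u , unitary-u , M≈diag) =
    1 , 1 , ModP.invertible-1 , ModQ.invertible-1 , u , unitary-u ,
    ≈ₘ-trans M≈diag (≈ₘ-sym (monomial-π-identity ModP.invertible-1 ModQ.invertible-1 refl refl u))

  standardForm-⊗ : ∀ {M N} → StandardForm M → StandardForm N → StandardForm (M ⊗ N)
  standardForm-⊗ (α₁ , β₁ , uα₁ , uβ₁ , u , unitary-u , M≈) (α₂ , β₂ , uα₂ , uβ₂ , v , unitary-v , N≈) =
    α₂ ℕ.* α₁ , β₂ ℕ.* β₁ , uα₂α₁ , uβ₂β₁ ,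
    w ,
    (λ i → unitary-mulCoeff (f₁ i) (f₂ (π₁ i)) (unitary-u i) (unitary-v (π₁ i))) ,
    ≈ₘ-trans (⊗-cong M≈ N≈) (≈ₘ-trans (monomial-⊗ π₁ f₁ u π₂ f₂ v)
      (monomial-cong {u = w} {u′ = w} (π-∘ uα₁ uβ₁ uα₂ uβ₂) flips≡ (λ _ → ≈-refl)))
    where
    uα₂α₁ = ModP.invertible-* uα₂ uα₁
    uβ₂β₁ = ModQ.invertible-* uβ₂ uβ₁
    π₁ = π uα₁ uβ₁
    f₁ = flips uα₁ uβ₁
    π₂ = π uα₂ uβ₂
    f₂ = flips uα₂ uβ₂
    w = λ i → mulCoeff (f₁ i) (f₂ (π₁ i)) (u i) (v (π₁ i))
    flips≡ : ∀ i → f₁ i xor f₂ (π₁ i) ≡ flips uα₂α₁ uβ₂β₁ i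
    flips≡ i = trans (cong (f₁ i xor_) (flips-∘ uα₁ uβ₁ uα₂ uβ₂ i)) (xor-cancelˡ (f₁ i) _)

  standardForm-inverse : ∀ {M N} → StandardForm M → (M ⊗ N) ≈ₘ one → StandardForm N
  standardForm-inverse {M} {N} (α , β , uα , uβ , u , unitary-u , M≈) MN≈one =
    ModP.inverse uα , ModQ.inverse uβ , uα⁻¹ , uβ⁻¹ ,
    w ,
    (λ l → unitary-invCoeff (f (π⁻¹ l)) (unitary-u (π⁻¹ l))) ,
    ≈ₘ-trans (monomial-right-inverse {M} {N} {π uα uβ} {π⁻¹} {f} {u} M≈ unitary-u ππ⁻¹ MN≈one)
             (monomial-cong {π⁻¹} {π⁻¹} {u = w} {u′ = w} (λ _ → refl) flips≡ (λ _ → ≈-refl))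
    where
    uα⁻¹ = ModP.invertible-inverse uα
    uβ⁻¹ = ModQ.invertible-inverse uβ
    f = flips uα uβ
    π⁻¹ = π uα⁻¹ uβ⁻¹
    w = λ l → invCoeff (f (π⁻¹ l)) (u (π⁻¹ l))
    identity = π-identity (ModP.invertible-* uα uα⁻¹) (ModQ.invertible-* uβ uβ⁻¹) (ModP.inverseʳ uα) (ModQ.inverseʳ uβ)
    ππ⁻¹ : ∀ l → π uα uβ (π⁻¹ l) ≡ l
    ππ⁻¹ l = trans (π-∘ uα⁻¹ uβ⁻¹ uα uβ l) (proj₁ (identity l))
    flips≡ : ∀ l → f (π⁻¹ l) ≡ flips uα⁻¹ uβ⁻¹ l
    flips≡ l = trans (flips-∘ uα⁻¹ uβ⁻¹ uα uβ l)
                     (trans (cong (flips uα⁻¹ uβ⁻¹ l xor_) (proj₂ (identity l))) (Boolₚ.xor-identityʳ _))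

  standardForm-resp : ∀ {M N} → M ≈ₘ N → StandardForm M → StandardForm N
  standardForm-resp M≈N (α , β , uα , uβ , u , unitary-u , M≈) =
    α , β , uα , uβ , u , unitary-u , ≈ₘ-trans (≈ₘ-sym M≈N) M≈

  module _ {c d} (uc : ModP.Invertible c) (ud : ModQ.Invertible d) where

    standardForm : ∀ {M} → InG c d M → StandardForm M
    standardForm (gen-U1 M∈U1)          = standardForm-U1 M∈U1
    standardForm gen-γq                 =
      1 , d , ModP.invertible-1 , ud , (λ _ → 1#) , (λ _ → unitary-1) , γq≈monomial ud
    standardForm gen-γp                 =
      c , 1 , uc , ModQ.invertible-1 , (λ _ → 1#) , (λ _ → unitary-1) , γp≈monomial uc
    standardForm g-one                  = standardForm-U1 ((λ _ → 1#) , (λ _ → unitary-1) , ≈ₘ-sym diagU-1)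
    standardForm (g-mul M∈G N∈G)        = standardForm-⊗ (standardForm M∈G) (standardForm N∈G)
    standardForm (g-inv M∈G MN≈one _)   = standardForm-inverse (standardForm M∈G) MN≈one
    standardForm (g-resp M≈N M∈G)       = standardForm-resp M≈N (standardForm M∈G)

  trace-standardForm : ∀ {M} → StandardForm M → ¬ InU1g M → trace M ≈ 0#
  trace-standardForm {M} (α , β , uα , uβ , u , unitary-u , M≈) M∉U1 =
    trace-monomial {M} {π uα uβ} {flips uα uβ} {u} M≈ no-fixed-point
    where
    no-fixed-point : ∀ i → π uα uβ i ≡ i → flips uα uβ i ≢ false
    no-fixed-point i πi≡i flips≡false = M∉U1 (u , unitary-u , ≈ₘ-trans {M} M≈ (monomial-π-identity uα uβ α≡1 β≡1 u))
      where
      α≡1 = proj₁ (fixed⇒identity uα uβ i πi≡i flips≡false)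
      β≡1 = proj₂ (fixed⇒identity uα uβ i πi≡i flips≡false)

proposition5p1 : {a ℓ : Level} (p q : ℕ) → Prime p → Prime q → p ≢ 2 → q ≢ 2 → p ≢ q →
    (c d : ℕ) → IsGenerator p c → IsGenerator q d →
    (R : CommutativeRing a ℓ) (inv : Catalan.Matrices.Involution p q R) →
    let open Catalan.Matrices p q R
        open WithConj inv
    in (M : Mat) → InG c d M → ¬ InU1g M → CommutativeRing._≈_ R (trace M) (CommutativeRing.0# R)
proposition5p1 p q pp pq p≢2 q≢2 p≢q c d gen-c gen-d R inv M M∈G M∉U1
  with odd-prime⇒3+ pp p≢2 | odd-prime⇒3+ pq q≢2
... | p‴ , refl | q‴ , refl = trace-standardForm (standardForm uc ud M∈G) M∉U1
  where
  open Generators (suc p‴) (suc q‴) pp pq p≢q R inv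
  3≤ : ∀ {n} → 3 ≤ 3 ℕ.+ n
  3≤ = s≤s (s≤s (s≤s z≤n))
  uc = Modular.generator⇒invertible (suc p‴) pp 3≤ gen-c
  ud = Modular.generator⇒invertible (suc q‴) pq 3≤ gen-d
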